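{- 1. For all positive integers $l,s$, there is a perfect $4^l$-coloring of $H(n,4)$, where $n=\frac{s(4^l-1)}{3}$, with quotient matrix $s(J-E)$. 2. For all integers $l\ge 2$ and $s\ge 2$, there is a perfect $2^{2l-1}$-coloring of $H(n,4)$, where $n=\frac{s(2^{2l-1}-1)+a}{3}$, with quotient matrix $s(J-E)+aE$, where $a=0$ if $s\equiv 0$, $a=1$ if $s\equiv 2$, and $a=2$ if $s\equiv 1 \pmod 3$. 3. For every integer $l\ge 2$ and all nonnegative $m,n$ with $2m+n=\frac{2^{2l}-1}{3}$, there is a perfect $2^{2l-1}$-coloring of $D(m,n)$ with quotient matrix $2(J-E)+E$. 4. For every integer $l\ge 2$, there is a perfect $2^{2l-1}$-coloring of $D(m,0)$, where $2m=\frac{2(2^{2l-1}+1)}{3}$, with quotient matrix $2(J-E)+4E$.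
   Context: The Shrikhande graph is the Cayley graph on $\mathbb{Z}_4^2$ with connection set $\{01,03,10,30,11,33\}$. For nonnegative integers $m,n$, $D(m,n)$ is the Cartesian product of $m$ copies of the Shrikhande graph and $n$ copies of $K_4$ (vertex set $(\mathbb{Z}_4^2)^m\times\mathbb{Z}_4^n$; adjacent iff differing in exactly one coordinate by an adjacency of that factor); $H(n,4)=D(0,n)$. A $k$-coloring is a surjective map onto a $k$-element color set; it is perfect with quotient matrix $S=(s_{ij})$ if every vertex of color $i$ has exactly $s_{ij}$ neighbours of color $j$. $J$ is the all-ones matrix and $E$ the identity matrix, of the appropriate order. -}

module Defs where

open import Data.Nat using (ℕ; zero; suc; _+_; _*_; _∸_; _^_; _%_)
open import Data.Bool using (Bool; true; false; _∧_; _∨_; if_then_else_)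
open import Data.Fin using (Fin; toℕ; fromℕ<)
import Data.Fin as Fin
open import Data.Fin.Properties using () renaming (_≟_ to _≟ᶠ_)
open import Data.Product using (_×_; _,_; Σ; ∃)
open import Data.List using (List; []; _∷_; map; concatMap; allFin)
open import Data.Vec using (Vec; []; _∷_)
open import Relation.Nullary.Decidable using (⌊_⌋)
open import Relation.Binary.PropositionalEquality using (_≡_)

Z4 : Set
Z4 = Fin 4

_==₄_ : Z4 → Z4 → Bool
a ==₄ b = ⌊ a ≟ᶠ b ⌋

sub₄ : Z4 → Z4 → ℕ
sub₄ a b = (4 + toℕ a ∸ toℕ b) % 4

adjK4 : Z4 → Z4 → Bool
adjK4 a b = if a ==₄ b then false else true

inConn : ℕ → ℕ → Bool
inConn 0 1 = true
inConn 0 3 = true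
inConn 1 0 = true
inConn 3 0 = true
inConn 1 1 = true
inConn 3 3 = true
inConn _ _ = false

-- Shrikhande graph: Cayley graph on ℤ₄² with the above connection set
adjShr : Z4 × Z4 → Z4 × Z4 → Bool
adjShr (a₁ , a₂) (b₁ , b₂) = inConn (sub₄ a₁ b₁) (sub₄ a₂ b₂)

eqVec : {A : Set} → (A → A → Bool) → {k : ℕ} → Vec A k → Vec A k → Bool
eqVec eq [] [] = true
eqVec eq (x ∷ xs) (y ∷ ys) = eq x y ∧ eqVec eq xs ys

adjVec : {A : Set} → (A → A → Bool) → (A → A → Bool) → {k : ℕ} → Vec A k → Vec A k → Bool
adjVec eq adj [] [] = false
adjVec eq adj (x ∷ xs) (y ∷ ys) =
  (eq x y ∧ adjVec eq adj xs ys) ∨ (adj x y ∧ eqVec eq xs ys)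

_==₄₂_ : Z4 × Z4 → Z4 × Z4 → Bool
(a₁ , a₂) ==₄₂ (b₁ , b₂) = (a₁ ==₄ b₁) ∧ (a₂ ==₄ b₂)

Vertex : ℕ → ℕ → Set
Vertex m n = Vec (Z4 × Z4) m × Vec Z4 n

adjD : {m n : ℕ} → Vertex m n → Vertex m n → Bool
adjD (x , u) (y , v) =
  (adjVec _==₄₂_ adjShr x y ∧ eqVec _==₄_ u v) ∨
  (eqVec _==₄₂_ x y ∧ adjVec _==₄_ adjK4 u v)

allVecs : {A : Set} → List A → (k : ℕ) → List (Vec A k)
allVecs xs zero = [] ∷ []
allVecs xs (suc k) = concatMap (λ x → map (x ∷_) (allVecs xs k)) xs

allZ4 : List Z4
allZ4 = allFin 4

allZ4² : List (Z4 × Z4)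
allZ4² = concatMap (λ a → map (a ,_) allZ4) allZ4

allVertices : (m n : ℕ) → List (Vertex m n)
allVertices m n = concatMap (λ x → map (x ,_) (allVecs allZ4 n)) (allVecs allZ4² m)

count : {A : Set} → (A → Bool) → List A → ℕ
count p [] = 0
count p (x ∷ xs) = if p x then suc (count p xs) else count p xs

nbrsOfColour : {m n k : ℕ} → (Vertex m n → Fin k) → Vertex m n → Fin k → ℕ
nbrsOfColour {m} {n} c v j =
  count (λ w → adjD v w ∧ ⌊ c w ≟ᶠ j ⌋) (allVertices m n)

IsPerfectColouring : (m n k : ℕ) → (Vertex m n → Fin k) → (Fin k → Fin k → ℕ) → Set
IsPerfectColouring m n k c S =
  (∀ (i : Fin k) → ∃ λ v → c v ≡ i) ×
  (∀ (v : Vertex m n) (j : Fin k) → nbrsOfColour c v j ≡ S (c v) j)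

HasPerfectColouring : (m n k : ℕ) → (Fin k → Fin k → ℕ) → Set
HasPerfectColouring m n k S = Σ (Vertex m n → Fin k) λ c → IsPerfectColouring m n k c S

sJE+aE : {k : ℕ} → ℕ → ℕ → Fin k → Fin k → ℕ
sJE+aE s a i j = if ⌊ i ≟ᶠ j ⌋ then a else s

aOf : ℕ → ℕ
aOf s with s % 3
... | 0 = 0
... | 1 = 2
... | _ = 1

module Submission where

-- Every colouring below is a group colouring. Each Shrikhande factor of D(m,n) is the Cayley graph of ℤ₄² and
-- each K₄ factor that of 𝔽₄⁺ (or ℤ₄); labelling factor i by a homomorphism φᵢ into a finite abelian group G and
-- colouring a vertex by the sum of its labels, the neighbours of any vertex v get the colours colour(v) + d, where
-- d runs over the multiset D of images of the connection sets. So the colouring is perfect with quotient matrix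
-- s(J − E) + aE as soon as D contains every nonzero element of G exactly s times and 0 exactly a times.
--
-- Such multisets are built in G = C × 𝔽₄ʳ: a multiset T in C × 𝔽₄ is lifted along (c , α) ↦ (c , α h) for one
-- representative h of every line through the origin of 𝔽₄ʳ. Every nonzero vector is αh for exactly one such h and
-- α ≠ 0, so if T contains every (c , α ≠ 0) exactly λ times, the lift contains every element outside C × 0 exactly
-- λ times, and a small design inside C × 0 covers the rest.

open import Defs

open import Algebra.Bundles using (AbelianGroup)
import Algebra.Definitions
import Algebra.Properties.AbelianGroup
import Algebra.Properties.CommutativeSemigroup
open import Data.Bool using (Bool; true; false; _∧_; _∨_; if_then_else_)
open import Data.Bool.Properties using (∨-identityʳ)
import Data.Bool.Properties as Bool
open import Data.Empty using (⊥-elim)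
open import Data.Fin using (Fin; zero; suc; toℕ; fromℕ<)
open import Data.Fin.Properties using (all?; toℕ-fromℕ<; *↔×) renaming (_≟_ to _≟ᶠ_)
open import Data.List using (List; []; _∷_; map; concatMap; concat; _++_; length; filterᵇ; take; drop)
import Data.List as List
open import Data.List.Properties
  using (concatMap-++; concatMap-cong; length-++; length-map; take++drop≡id; length-take; length-drop)
import Data.List.Properties
open import Data.Nat using (ℕ; zero; suc; pred; s≤s; z≤n; _+_; _*_; _∸_; _^_; _≤_; >-nonZero; NonZero)
import Data.Nat as ℕ
open import Data.Nat.DivMod using (_%_; _/_; m%n<n; m≡m%n+[m/n]*n; [m+kn]%n≡m%n)
open import Data.Nat.Properties
  using ( +-identityʳ; +-assoc; +-comm; +-suc; +-cancelˡ-≡; *-zeroʳ; *-identityʳ; *-comm; *-assoc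
        ; *-distribˡ-+; *-cancelˡ-≡; suc-injective; suc-pred; m+n∸n≡m; m+[n∸m]≡n; m≤n⇒m⊓n≡m
        ; ≤-trans; _≤?_; ≰⇒>; ^-distribˡ-+-*; ^-*-assoc; +-commutativeSemigroup )
open import Algebra.Properties.CommutativeSemigroup +-commutativeSemigroup using () renaming (interchange to +-interchange)
open import Data.Nat.Tactic.RingSolver using (solve-∀)
open import Data.Product using (_×_; _,_; proj₁; proj₂; ∃; uncurry)
open import Data.Product.Function.NonDependent.Propositional using (_×-↔_)
open import Data.Product.Properties using (,-injectiveˡ; ,-injectiveʳ)
open import Data.Sum using (_⊎_; inj₁; inj₂)
open import Data.Vec using (Vec; []; _∷_; zipWith; replicate)
import Data.Vec
import Data.Vec.Properties as Vec
open import Function.Bundles using (_↔_; Inverse; mk↔ₛ′)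
open import Function.Properties.Inverse using (↔-refl; ↔-sym; ↔-trans)
open import Level using (0ℓ)
open import Relation.Binary.Definitions using (DecidableEquality)
open import Relation.Binary.PropositionalEquality
open import Relation.Nullary using (Dec; ¬_)
open import Relation.Nullary.Decidable
  using (⌊_⌋; yes; no; from-yes; dec-true; dec-false; isYes≗does; map′; _×-dec_; _→-dec_; ¬?; True; toWitness)

pattern 0F = zero
pattern 1F = suc zero
pattern 2F = suc (suc zero)
pattern 3F = suc (suc (suc zero))

⌊⌋-⇔ : {P Q : Set} (p : Dec P) (q : Dec Q) → (P → Q) → (Q → P) → ⌊ p ⌋ ≡ ⌊ q ⌋
⌊⌋-⇔ (yes _) (yes _) _ _ = refl
⌊⌋-⇔ (yes p) (no ¬q) f _ = ⊥-elim (¬q (f p))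
⌊⌋-⇔ (no ¬p) (yes q) _ g = ⊥-elim (¬p (g q))
⌊⌋-⇔ (no _) (no _) _ _ = refl

Bool-⇔ : {b c : Bool} → (b ≡ true → c ≡ true) → (c ≡ true → b ≡ true) → b ≡ c
Bool-⇔ {true} f g = sym (f refl)
Bool-⇔ {false} {false} f g = refl
Bool-⇔ {false} {true} f g = g refl

⌊⌋-false : {P : Set} (p : Dec P) → ¬ P → ⌊ p ⌋ ≡ false
⌊⌋-false p ¬p = trans (isYes≗does p) (dec-false p ¬p)

𝟙 : Bool → ℕ
𝟙 b = if b then 1 else 0

∑ : {A : Set} → List A → (A → ℕ) → ℕ
∑ [] f = 0
∑ (x ∷ xs) f = f x + ∑ xs f

syntax ∑ xs (λ x → e) = ∑[ x ∈ xs ] e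

module _ {A : Set} where

  count≡∑𝟙 : (p : A → Bool) (xs : List A) → count p xs ≡ ∑[ x ∈ xs ] 𝟙 (p x)
  count≡∑𝟙 p [] = refl
  count≡∑𝟙 p (x ∷ xs) with p x
  ... | true = cong suc (count≡∑𝟙 p xs)
  ... | false = count≡∑𝟙 p xs

  ∑-cong : {f g : A → ℕ} → (∀ x → f x ≡ g x) → (xs : List A) → ∑ xs f ≡ ∑ xs g
  ∑-cong f≗g [] = refl
  ∑-cong f≗g (x ∷ xs) = cong₂ _+_ (f≗g x) (∑-cong f≗g xs)

  count-cong : {p q : A → Bool} → (∀ x → p x ≡ q x) → (xs : List A) → count p xs ≡ count q xs
  count-cong p≗q [] = refl
  count-cong {p} {q} p≗q (x ∷ xs) rewrite p≗q x with q x
  ... | true = cong suc (count-cong p≗q xs)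
  ... | false = count-cong p≗q xs

  ∑-++ : (xs ys : List A) (f : A → ℕ) → ∑ (xs ++ ys) f ≡ ∑ xs f + ∑ ys f
  ∑-++ [] ys f = refl
  ∑-++ (x ∷ xs) ys f = trans (cong (f x +_) (∑-++ xs ys f)) (sym (+-assoc (f x) _ _))

  count-++ : (p : A → Bool) (xs ys : List A) → count p (xs ++ ys) ≡ count p xs + count p ys
  count-++ p [] ys = refl
  count-++ p (x ∷ xs) ys with p x
  ... | true = cong suc (count-++ p xs ys)
  ... | false = count-++ p xs ys

  count≡suc⇒∃ : (p : A → Bool) (xs : List A) {k : ℕ} → count p xs ≡ suc k → ∃ λ x → p x ≡ true
  count≡suc⇒∃ p (x ∷ xs) e with p x in px
  ... | true = x , px
  ... | false = count≡suc⇒∃ p xs e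

  count-filter : (p q : A → Bool) (xs : List A) → count p (filterᵇ q xs) ≡ count (λ x → q x ∧ p x) xs
  count-filter p q [] = refl
  count-filter p q (x ∷ xs) with q x
  ... | true = cong (λ n → if p x then suc n else n) (count-filter p q xs)
  ... | false = count-filter p q xs

  ∑-0 : (xs : List A) → ∑[ x ∈ xs ] 0 ≡ 0
  ∑-0 [] = refl
  ∑-0 (x ∷ xs) = ∑-0 xs

  ∑-+ : (xs : List A) (f g : A → ℕ) → ∑[ x ∈ xs ] (f x + g x) ≡ ∑ xs f + ∑ xs g
  ∑-+ [] f g = refl
  ∑-+ (x ∷ xs) f g = trans (cong (f x + g x +_) (∑-+ xs f g)) (+-interchange (f x) (g x) _ _)

  ∑-*ˡ : (k : ℕ) (xs : List A) (f : A → ℕ) → ∑[ x ∈ xs ] (k * f x) ≡ k * ∑ xs f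
  ∑-*ˡ k [] f = sym (*-zeroʳ k)
  ∑-*ˡ k (x ∷ xs) f = trans (cong (k * f x +_) (∑-*ˡ k xs f)) (sym (*-distribˡ-+ k (f x) _))

  ∑-if : (p q : A → Bool) (xs : List A) → ∑[ x ∈ xs ] (if p x then 𝟙 (q x) else 0) ≡ count (λ x → p x ∧ q x) xs
  ∑-if p q xs = trans (∑-cong (λ x → if-𝟙 (p x) (q x)) xs) (sym (count≡∑𝟙 _ xs))
    where
    if-𝟙 : ∀ a b → (if a then 𝟙 b else 0) ≡ 𝟙 (a ∧ b)
    if-𝟙 true b = refl
    if-𝟙 false b = refl

module _ {A B : Set} where

  ∑-map : (g : A → B) (xs : List A) (f : B → ℕ) → ∑ (map g xs) f ≡ ∑[ x ∈ xs ] f (g x)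
  ∑-map g [] f = refl
  ∑-map g (x ∷ xs) f = cong (f (g x) +_) (∑-map g xs f)

  ∑-concatMap : (g : A → List B) (xs : List A) (f : B → ℕ) → ∑ (concatMap g xs) f ≡ ∑[ x ∈ xs ] ∑ (g x) f
  ∑-concatMap g [] f = refl
  ∑-concatMap g (x ∷ xs) f = trans (∑-++ (g x) (concatMap g xs) f) (cong (∑ (g x) f +_) (∑-concatMap g xs f))

  ∑-comm : (xs : List A) (ys : List B) (f : A → B → ℕ) → ∑[ x ∈ xs ] ∑[ y ∈ ys ] f x y ≡ ∑[ y ∈ ys ] ∑[ x ∈ xs ] f x y
  ∑-comm [] ys f = sym (∑-0 ys)
  ∑-comm (x ∷ xs) ys f = trans (cong (∑ ys (f x) +_) (∑-comm xs ys f)) (sym (∑-+ ys (f x) (λ y → ∑[ x ∈ xs ] f x y)))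

  concatMap-concatMap : {C : Set} (f : B → List C) (g : A → List B) (xs : List A) →
    concatMap f (concatMap g xs) ≡ concatMap (λ x → concatMap f (g x)) xs
  concatMap-concatMap f g [] = refl
  concatMap-concatMap f g (x ∷ xs) =
    trans (concatMap-++ f (g x) (concatMap g xs)) (cong (concatMap f (g x) ++_) (concatMap-concatMap f g xs))

  count-map : (p : B → Bool) (g : A → B) (xs : List A) → count p (map g xs) ≡ count (λ x → p (g x)) xs
  count-map p g [] = refl
  count-map p g (x ∷ xs) with p (g x)
  ... | true = cong suc (count-map p g xs)
  ... | false = count-map p g xs

  count-concatMap : (p : B → Bool) (g : A → List B) (xs : List A) → count p (concatMap g xs) ≡ ∑[ x ∈ xs ] count p (g x)
  count-concatMap p g [] = refl
  count-concatMap p g (x ∷ xs) = trans (count-++ p (g x) (concatMap g xs)) (cong (count p (g x) +_) (count-concatMap p g xs))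

count-∧ˡ : {A : Set} (b : Bool) (p : A → Bool) (xs : List A) → count (λ x → b ∧ p x) xs ≡ (if b then count p xs else 0)
count-∧ˡ true p xs = refl
count-∧ˡ false p xs = trans (count≡∑𝟙 _ xs) (∑-0 xs)

length-concat-replicate : {A : Set} (k : ℕ) (xs : List A) → length (concat (List.replicate k xs)) ≡ k * length xs
length-concat-replicate zero xs = refl
length-concat-replicate (suc k) xs = trans (length-++ xs) (cong (length xs +_) (length-concat-replicate k xs))

length-concatMap : {A B : Set} (k : ℕ) (f : A → List B) → (∀ x → length (f x) ≡ k) → (xs : List A) →
  length (concatMap f xs) ≡ length xs * k
length-concatMap k f len [] = refl
length-concatMap k f len (x ∷ xs) = trans (length-++ (f x)) (cong₂ _+_ (len x) (length-concatMap k f len xs))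

length-copies : {A : Set} (k : ℕ) (xs : List A) → length (concatMap (List.replicate k) xs) ≡ length xs * k
length-copies k = length-concatMap k (List.replicate k) (λ x → Data.List.Properties.length-replicate k)

length-allVecs : ∀ r → length (allVecs allZ4 r) ≡ 4 ^ r
length-allVecs zero = refl
length-allVecs (suc r) =
  trans (length-concatMap (length (allVecs allZ4 r)) (λ y → map (y ∷_) (allVecs allZ4 r))
                          (λ y → length-map (y ∷_) (allVecs allZ4 r)) allZ4)
        (cong (4 *_) (length-allVecs r))

-- Cartesian products of graphs

record FactorGraph (A : Set) : Set where
  field
    _==_ : A → A → Bool
    adj : A → A → Bool
    vertices : List A
    ==-sound : ∀ {a b} → (a == b) ≡ true → a ≡ b
    ==-refl : ∀ a → (a == a) ≡ true
    adj-irrefl : ∀ a → adj a a ≡ false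
    ∑-select : ∀ x (f : A → ℕ) → ∑[ y ∈ vertices ] (if x == y then f y else 0) ≡ f x

nbrCount : {A : Set} (adj : A → A → Bool) (xs : List A) {k : ℕ} → Vec A k → (Vec A k → Bool) → ℕ
nbrCount adj xs [] P = 0
nbrCount adj xs (x ∷ v) P = count (λ y → adj x y ∧ P (y ∷ v)) xs + nbrCount adj xs v (λ w → P (x ∷ w))

nbrCount-cong : {A : Set} (adj : A → A → Bool) (xs : List A) {k : ℕ} (v : Vec A k) {P Q : Vec A k → Bool} →
  (∀ w → P w ≡ Q w) → nbrCount adj xs v P ≡ nbrCount adj xs v Q
nbrCount-cong adj xs [] P≗Q = refl
nbrCount-cong adj xs (x ∷ v) P≗Q =
  cong₂ _+_ (count-cong (λ y → cong (adj x y ∧_) (P≗Q (y ∷ v))) xs) (nbrCount-cong adj xs v (λ w → P≗Q (x ∷ w)))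

module FactorGraphPower {A : Set} (G : FactorGraph A) where
  open FactorGraph G

  eqVec-sound : ∀ {k} {x y : Vec A k} → eqVec _==_ x y ≡ true → x ≡ y
  eqVec-sound {x = []} {[]} _ = refl
  eqVec-sound {x = x ∷ v} {y ∷ w} e with x == y in x==y
  ... | true = cong₂ _∷_ (==-sound x==y) (eqVec-sound e)

  adjVec-irrefl : ∀ {k} (x : Vec A k) → adjVec _==_ adj x x ≡ false
  adjVec-irrefl [] = refl
  adjVec-irrefl (x ∷ v) rewrite ==-refl x | adj-irrefl x | adjVec-irrefl v = refl

  ∑-selectVec : ∀ k (x : Vec A k) (f : Vec A k → ℕ) →
    ∑[ w ∈ allVecs vertices k ] (if eqVec _==_ x w then f w else 0) ≡ f x
  ∑-selectVec zero [] f = +-identityʳ (f [])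
  ∑-selectVec (suc k) (x ∷ v) f =
    begin
      ∑[ w ∈ allVecs vertices (suc k) ] (if eqVec _==_ (x ∷ v) w then f w else 0)
    ≡⟨ ∑-concatMap (λ y → map (y ∷_) (allVecs vertices k)) vertices _ ⟩
      ∑[ y ∈ vertices ] ∑ (map (y ∷_) (allVecs vertices k)) (λ w → if eqVec _==_ (x ∷ v) w then f w else 0)
    ≡⟨ ∑-cong (λ y → trans (∑-map (y ∷_) (allVecs vertices k) _) (inner y)) vertices ⟩
      ∑[ y ∈ vertices ] (if x == y then f (y ∷ v) else 0)
    ≡⟨ ∑-select x (λ y → f (y ∷ v)) ⟩
      f (x ∷ v)
    ∎
    where
    open ≡-Reasoning
    inner : ∀ y → ∑[ w ∈ allVecs vertices k ] (if x == y ∧ eqVec _==_ v w then f (y ∷ w) else 0)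
                ≡ (if x == y then f (y ∷ v) else 0)
    inner y with x == y
    ... | true = ∑-selectVec k v (λ w → f (y ∷ w))
    ... | false = ∑-0 (allVecs vertices k)

  count-selectVec : ∀ k (x : Vec A k) (Q : Vec A k → Bool) →
    count (λ w → eqVec _==_ x w ∧ Q w) (allVecs vertices k) ≡ 𝟙 (Q x)
  count-selectVec k x Q =
    trans (sym (∑-if (eqVec _==_ x) Q (allVecs vertices k))) (∑-selectVec k x (λ w → 𝟙 (Q w)))

  count-adjVec : ∀ k (x : Vec A k) (P : Vec A k → Bool) →
    count (λ w → adjVec _==_ adj x w ∧ P w) (allVecs vertices k) ≡ nbrCount adj vertices x P
  count-adjVec zero [] P = refl
  count-adjVec (suc k) (x ∷ v) P =
    begin
      count (λ w → adjVec _==_ adj (x ∷ v) w ∧ P w) (allVecs vertices (suc k))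
    ≡⟨ count-concatMap _ (λ y → map (y ∷_) (allVecs vertices k)) vertices ⟩
      ∑[ y ∈ vertices ] count (λ w → adjVec _==_ adj (x ∷ v) w ∧ P w) (map (y ∷_) (allVecs vertices k))
    ≡⟨ ∑-cong (λ y → trans (count-map _ (y ∷_) (allVecs vertices k)) (split y)) vertices ⟩
      ∑[ y ∈ vertices ] ((if x == y then count (λ w → adjVec _==_ adj v w ∧ P (y ∷ w)) (allVecs vertices k) else 0)
                        + (if adj x y then 𝟙 (P (y ∷ v)) else 0))
    ≡⟨ ∑-+ vertices _ _ ⟩
      ∑[ y ∈ vertices ] (if x == y then count (λ w → adjVec _==_ adj v w ∧ P (y ∷ w)) (allVecs vertices k) else 0)
      + ∑[ y ∈ vertices ] (if adj x y then 𝟙 (P (y ∷ v)) else 0)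
    ≡⟨ cong₂ _+_ (∑-select x (λ y → count (λ w → adjVec _==_ adj v w ∧ P (y ∷ w)) (allVecs vertices k)))
                 (∑-if (adj x) (λ y → P (y ∷ v)) vertices) ⟩
      count (λ w → adjVec _==_ adj v w ∧ P (x ∷ w)) (allVecs vertices k) + count (λ y → adj x y ∧ P (y ∷ v)) vertices
    ≡⟨ cong (_+ count (λ y → adj x y ∧ P (y ∷ v)) vertices) (count-adjVec k v (λ w → P (x ∷ w))) ⟩
      nbrCount adj vertices v (λ w → P (x ∷ w)) + count (λ y → adj x y ∧ P (y ∷ v)) vertices
    ≡⟨ +-comm (nbrCount adj vertices v (λ w → P (x ∷ w))) _ ⟩
      nbrCount adj vertices (x ∷ v) P
    ∎
    where
    open ≡-Reasoning
    split : ∀ y → count (λ w → ((x == y ∧ adjVec _==_ adj v w) ∨ (adj x y ∧ eqVec _==_ v w)) ∧ P (y ∷ w)) (allVecs vertices k)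
      ≡ (if x == y then count (λ w → adjVec _==_ adj v w ∧ P (y ∷ w)) (allVecs vertices k) else 0)
        + (if adj x y then 𝟙 (P (y ∷ v)) else 0)
    split y with x == y in x==y
    ... | true rewrite sym (==-sound x==y) | adj-irrefl x =
          trans (count-cong (λ w → cong (_∧ P (x ∷ w)) (∨-identityʳ _)) (allVecs vertices k)) (sym (+-identityʳ _))
    ... | false with adj x y
    ... | true = count-selectVec k v (λ w → P (y ∷ w))
    ... | false = trans (count≡∑𝟙 _ (allVecs vertices k)) (∑-0 (allVecs vertices k))

==₄-sound : ∀ {a b} → (a ==₄ b) ≡ true → a ≡ b
==₄-sound {a} {b} e with a ≟ᶠ b
... | yes a≡b = a≡b

==₄-refl : ∀ a → (a ==₄ a) ≡ true
==₄-refl a = trans (isYes≗does (a ≟ᶠ a)) (dec-true (a ≟ᶠ a) refl)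

∑-selectZ4 : ∀ x (f : Z4 → ℕ) → ∑[ y ∈ allZ4 ] (if x ==₄ y then f y else 0) ≡ f x
∑-selectZ4 0F f = +-identityʳ _
∑-selectZ4 1F f = +-identityʳ _
∑-selectZ4 2F f = +-identityʳ _
∑-selectZ4 3F f = +-identityʳ _

K4 : FactorGraph Z4
K4 = record
  { _==_ = _==₄_ ; adj = adjK4 ; vertices = allZ4
  ; ==-sound = ==₄-sound ; ==-refl = ==₄-refl
  ; adj-irrefl = λ a → cong (λ b → if b then false else true) (==₄-refl a)
  ; ∑-select = ∑-selectZ4
  }

∑-Z4² : (f : Z4 × Z4 → ℕ) → ∑ allZ4² f ≡ ∑[ a ∈ allZ4 ] ∑[ b ∈ allZ4 ] f (a , b)
∑-Z4² f = trans (∑-concatMap (λ a → map (a ,_) allZ4) allZ4 f) (∑-cong (λ a → ∑-map (a ,_) allZ4 f) allZ4)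

∑-selectZ4² : ∀ x (f : Z4 × Z4 → ℕ) → ∑[ y ∈ allZ4² ] (if x ==₄₂ y then f y else 0) ≡ f x
∑-selectZ4² (x₁ , x₂) f =
  trans (∑-Z4² (λ y → if (x₁ , x₂) ==₄₂ y then f y else 0)) (trans (∑-cong inner allZ4) (∑-selectZ4 x₁ (λ a → f (a , x₂))))
  where
  inner : ∀ a → ∑[ b ∈ allZ4 ] (if (x₁ ==₄ a) ∧ (x₂ ==₄ b) then f (a , b) else 0)
              ≡ (if x₁ ==₄ a then f (a , x₂) else 0)
  inner a with x₁ ==₄ a
  ... | true = ∑-selectZ4 x₂ (λ b → f (a , b))
  ... | false = ∑-0 allZ4

Shrikhande : FactorGraph (Z4 × Z4)
Shrikhande = record
  { _==_ = _==₄₂_ ; adj = adjShr ; vertices = allZ4²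
  ; ==-sound = λ {a} {b} → sound a b
  ; ==-refl = λ { (a₁ , a₂) → cong₂ _∧_ (==₄-refl a₁) (==₄-refl a₂) }
  ; adj-irrefl = λ { (a₁ , a₂) → from-yes (all? λ a₁ → all? λ a₂ → adjShr (a₁ , a₂) (a₁ , a₂) Bool.≟ false) a₁ a₂ }
  ; ∑-select = ∑-selectZ4²
  }
  where
  sound : ∀ a b → (a ==₄₂ b) ≡ true → a ≡ b
  sound (a₁ , a₂) (b₁ , b₂) e with a₁ ==₄ b₁ in e₁
  ... | true = cong₂ _,_ (==₄-sound e₁) (==₄-sound e)

module K4Power = FactorGraphPower K4
module ShrikhandePower = FactorGraphPower Shrikhande

count-adjD : ∀ m n (x : Vec (Z4 × Z4) m) (u : Vec Z4 n) (P : Vertex m n → Bool) →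
  count (λ w → adjD (x , u) w ∧ P w) (allVertices m n)
  ≡ nbrCount adjShr allZ4² x (λ x′ → P (x′ , u)) + nbrCount adjK4 allZ4 u (λ u′ → P (x , u′))
count-adjD m n x u P =
  begin
    count (λ w → adjD (x , u) w ∧ P w) (allVertices m n)
  ≡⟨ count-concatMap _ (λ x′ → map (x′ ,_) (allVecs allZ4 n)) (allVecs allZ4² m) ⟩
    ∑[ x′ ∈ allVecs allZ4² m ] count (λ w → adjD (x , u) w ∧ P w) (map (x′ ,_) (allVecs allZ4 n))
  ≡⟨ ∑-cong (λ x′ → trans (count-map _ (x′ ,_) (allVecs allZ4 n)) (split x′)) (allVecs allZ4² m) ⟩
    ∑[ x′ ∈ allVecs allZ4² m ] ((if eqVec _==₄₂_ x x′ then count (λ u′ → adjVec _==₄_ adjK4 u u′ ∧ P (x′ , u′)) (allVecs allZ4 n) else 0)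
                               + (if adjVec _==₄₂_ adjShr x x′ then 𝟙 (P (x′ , u)) else 0))
  ≡⟨ ∑-+ (allVecs allZ4² m) _ _ ⟩
    ∑[ x′ ∈ allVecs allZ4² m ] (if eqVec _==₄₂_ x x′ then count (λ u′ → adjVec _==₄_ adjK4 u u′ ∧ P (x′ , u′)) (allVecs allZ4 n) else 0)
    + ∑[ x′ ∈ allVecs allZ4² m ] (if adjVec _==₄₂_ adjShr x x′ then 𝟙 (P (x′ , u)) else 0)
  ≡⟨ cong₂ _+_ (ShrikhandePower.∑-selectVec m x (λ x′ → count (λ u′ → adjVec _==₄_ adjK4 u u′ ∧ P (x′ , u′)) (allVecs allZ4 n)))
               (∑-if (adjVec _==₄₂_ adjShr x) (λ x′ → P (x′ , u)) (allVecs allZ4² m)) ⟩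
    count (λ u′ → adjVec _==₄_ adjK4 u u′ ∧ P (x , u′)) (allVecs allZ4 n)
    + count (λ x′ → adjVec _==₄₂_ adjShr x x′ ∧ P (x′ , u)) (allVecs allZ4² m)
  ≡⟨ cong₂ _+_ (K4Power.count-adjVec n u (λ u′ → P (x , u′))) (ShrikhandePower.count-adjVec m x (λ x′ → P (x′ , u))) ⟩
    nbrCount adjK4 allZ4 u (λ u′ → P (x , u′)) + nbrCount adjShr allZ4² x (λ x′ → P (x′ , u))
  ≡⟨ +-comm (nbrCount adjK4 allZ4 u (λ u′ → P (x , u′))) _ ⟩
    nbrCount adjShr allZ4² x (λ x′ → P (x′ , u)) + nbrCount adjK4 allZ4 u (λ u′ → P (x , u′))
  ∎
  where
  open ≡-Reasoning
  split : ∀ x′ → count (λ u′ → adjD (x , u) (x′ , u′) ∧ P (x′ , u′)) (allVecs allZ4 n)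
    ≡ (if eqVec _==₄₂_ x x′ then count (λ u′ → adjVec _==₄_ adjK4 u u′ ∧ P (x′ , u′)) (allVecs allZ4 n) else 0)
      + (if adjVec _==₄₂_ adjShr x x′ then 𝟙 (P (x′ , u)) else 0)
  split x′ with eqVec _==₄₂_ x x′ in x≡x′
  ... | true rewrite trans (cong (adjVec _==₄₂_ adjShr x) (sym (ShrikhandePower.eqVec-sound x≡x′))) (ShrikhandePower.adjVec-irrefl x) =
          sym (+-identityʳ _)
  ... | false with adjVec _==₄₂_ adjShr x x′
  ... | true = trans (count-cong (λ u′ → cong (_∧ P (x′ , u′)) (∨-identityʳ _)) (allVecs allZ4 n))
                     (K4Power.count-selectVec n u (λ u′ → P (x′ , u′)))
  ... | false = trans (count-cong (λ u′ → cong (_∧ P (x′ , u′)) (∨-identityʳ _)) (allVecs allZ4 n))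
                      (trans (count≡∑𝟙 _ (allVecs allZ4 n)) (∑-0 (allVecs allZ4 n)))

origin : ∀ {m n} → Vertex m n
origin {m} {n} = replicate m (0F , 0F) , replicate n 0F

-- Every colour other than that of the origin occurs among its s ≥ 1 neighbours.
perfect⇒surjective : ∀ {m n k s a} (c : Vertex m n → Fin k) → 1 ≤ s →
  (∀ v j → nbrsOfColour c v j ≡ sJE+aE s a (c v) j) → ∀ i → ∃ λ v → c v ≡ i
perfect⇒surjective {m} {n} {k} {s} {a} c 1≤s perfect i with c origin ≟ᶠ i
... | yes c≡i = origin , c≡i
... | no c≢i with count≡suc⇒∃ (λ w → adjD (origin {m} {n}) w ∧ ⌊ c w ≟ᶠ i ⌋) (allVertices m n)
                   (trans (perfect origin i) (trans (cong (λ b → if b then a else s) (⌊⌋-false (c origin ≟ᶠ i) c≢i))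
                                                    (sym (suc-pred s {{>-nonZero 1≤s}}))))
... | w , adj∧c≡i = w , colour-of adj∧c≡i
  where
  colour-of : adjD (origin {m} {n}) w ∧ ⌊ c w ≟ᶠ i ⌋ ≡ true → c w ≡ i
  colour-of e with adjD (origin {m} {n}) w | c w ≟ᶠ i
  ... | true | yes c≡i = c≡i
  colour-of () | true | no _
  colour-of () | false | _

-- Abelian groups with decidable equality

record DecAbelianGroup : Set₁ where
  infixl 7 _∙_
  infix 8 _⁻¹
  infix 4 _≟_
  field
    Carrier : Set
    _∙_ : Carrier → Carrier → Carrier
    ε : Carrier
    _⁻¹ : Carrier → Carrier
    _≟_ : DecidableEquality Carrier
  open Algebra.Definitions {A = Carrier} _≡_
  field
    assoc : Associative _∙_
    comm : Commutative _∙_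
    identityˡ : LeftIdentity ε _∙_
    inverseʳ : RightInverse ε _⁻¹ _∙_

  identityʳ : RightIdentity ε _∙_
  identityʳ x = trans (comm x ε) (identityˡ x)

  inverseˡ : LeftInverse ε _⁻¹ _∙_
  inverseˡ x = trans (comm (x ⁻¹) x) (inverseʳ x)

  abelianGroup : AbelianGroup 0ℓ 0ℓ
  abelianGroup = record
    { isAbelianGroup = record
      { isGroup = record
        { isMonoid = record
          { isSemigroup = record { isMagma = isMagma _∙_ ; assoc = assoc }
          ; identity = identityˡ , identityʳ }
        ; inverse = inverseˡ , inverseʳ
        ; ⁻¹-cong = cong _⁻¹ }
      ; comm = comm } }
    where open import Relation.Binary.PropositionalEquality.Algebra using (isMagma)

  open Algebra.Properties.AbelianGroup abelianGroup public using (\\-leftDividesˡ; y≈x\\z)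
  open Algebra.Properties.CommutativeSemigroup (AbelianGroup.commutativeSemigroup abelianGroup) public
    using (interchange; xy∙z≈xz∙y)

  multiplicity : List Carrier → Carrier → ℕ
  multiplicity ds z = count (λ d → ⌊ d ≟ z ⌋) ds

  multiplicity-++ : ∀ ds es z → multiplicity (ds ++ es) z ≡ multiplicity ds z + multiplicity es z
  multiplicity-++ ds es z = count-++ _ ds es

  Covers : List Carrier → ℕ → ℕ → Set
  Covers ds a s = ∀ z → multiplicity ds z ≡ (if ⌊ z ≟ ε ⌋ then a else s)

  covers-from-counts : ∀ ds es {a s} → (∀ z → multiplicity ds z + multiplicity es z ≡ (if ⌊ z ≟ ε ⌋ then a else s)) →
    Covers (ds ++ es) a s
  covers-from-counts ds es counts z = trans (multiplicity-++ ds es z) (counts z)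

  infixr 8 _·_
  _·_ : ℕ → Carrier → Carrier
  zero · g = ε
  suc n · g = n · g ∙ g

_×ᴳ_ : DecAbelianGroup → DecAbelianGroup → DecAbelianGroup
G ×ᴳ H = record
  { Carrier = G.Carrier × H.Carrier
  ; _∙_ = λ (a , x) (b , y) → (a G.∙ b , x H.∙ y)
  ; ε = (G.ε , H.ε)
  ; _⁻¹ = λ (a , x) → (a G.⁻¹ , x H.⁻¹)
  ; _≟_ = λ (a , x) (b , y) → map′ (uncurry (cong₂ _,_)) (λ e → ,-injectiveˡ e , ,-injectiveʳ e) (a G.≟ b ×-dec x H.≟ y)
  ; assoc = λ (a , x) (b , y) (c , z) → cong₂ _,_ (G.assoc a b c) (H.assoc x y z)
  ; comm = λ (a , x) (b , y) → cong₂ _,_ (G.comm a b) (H.comm x y)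
  ; identityˡ = λ (a , x) → cong₂ _,_ (G.identityˡ a) (H.identityˡ x)
  ; inverseʳ = λ (a , x) → cong₂ _,_ (G.inverseʳ a) (H.inverseʳ x)
  }
  where
  module G = DecAbelianGroup G
  module H = DecAbelianGroup H

⌊≟⌋-×ᴳ : (G H : DecAbelianGroup) → ∀ a x b y →
  ⌊ DecAbelianGroup._≟_ (G ×ᴳ H) (a , x) (b , y) ⌋ ≡ ⌊ DecAbelianGroup._≟_ G a b ⌋ ∧ ⌊ DecAbelianGroup._≟_ H x y ⌋
⌊≟⌋-×ᴳ G H a x b y =
  trans (isYes≗does ((G ×ᴳ H) .DecAbelianGroup._≟_ (a , x) (b , y)))
        (sym (cong₂ _∧_ (isYes≗does (DecAbelianGroup._≟_ G a b)) (isYes≗does (DecAbelianGroup._≟_ H x y))))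

_^ᴳ_ : DecAbelianGroup → ℕ → DecAbelianGroup
G ^ᴳ r = record
  { Carrier = Vec G.Carrier r
  ; _∙_ = zipWith G._∙_
  ; ε = replicate r G.ε
  ; _⁻¹ = Data.Vec.map G._⁻¹
  ; _≟_ = Vec.≡-dec G._≟_
  ; assoc = Vec.zipWith-assoc G.assoc
  ; comm = Vec.zipWith-comm G.comm
  ; identityˡ = Vec.zipWith-identityˡ G.identityˡ
  ; inverseʳ = Vec.zipWith-inverseʳ G.inverseʳ
  }
  where module G = DecAbelianGroup G

finiteAbelianGroup : ∀ {n} (_∙_ : Fin n → Fin n → Fin n) (ε : Fin n) (_⁻¹ : Fin n → Fin n) →
  {True (all? λ a → all? λ b → all? λ c → (a ∙ b) ∙ c ≟ᶠ a ∙ (b ∙ c))} →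
  {True (all? λ a → all? λ b → a ∙ b ≟ᶠ b ∙ a)} →
  {True (all? λ a → ε ∙ a ≟ᶠ a)} →
  {True (all? λ a → a ∙ (a ⁻¹) ≟ᶠ ε)} → DecAbelianGroup
finiteAbelianGroup {n} _∙_ ε _⁻¹ {as} {co} {idˡ} {invʳ} = record
  { Carrier = Fin n ; _∙_ = _∙_ ; ε = ε ; _⁻¹ = _⁻¹ ; _≟_ = _≟ᶠ_
  ; assoc = toWitness as ; comm = toWitness co ; identityˡ = toWitness idˡ ; inverseʳ = toWitness invʳ }

ℤ₂ : DecAbelianGroup
ℤ₂ = finiteAbelianGroup (λ a b → fromℕ< (m%n<n (toℕ a + toℕ b) 2)) 0F (λ a → a)

ℤ₄ : DecAbelianGroup
ℤ₄ = finiteAbelianGroup (λ a b → fromℕ< (m%n<n (toℕ a + toℕ b) 4)) 0F (λ a → fromℕ< (m%n<n (4 ∸ toℕ a) 4))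

ℤ₄² : DecAbelianGroup
ℤ₄² = ℤ₄ ×ᴳ ℤ₄

-- GF(4) = {0, 1, ω, ω²} is encoded as 0F, 1F, 2F, 3F.

infixl 6 _⊕_
infixl 7 _⊗_

_⊕_ : Fin 4 → Fin 4 → Fin 4
0F ⊕ b = b
a ⊕ 0F = a
1F ⊕ 1F = 0F
1F ⊕ 2F = 3F
1F ⊕ 3F = 2F
2F ⊕ 1F = 3F
2F ⊕ 2F = 0F
2F ⊕ 3F = 1F
3F ⊕ 1F = 2F
3F ⊕ 2F = 1F
3F ⊕ 3F = 0F

_⊗_ : Fin 4 → Fin 4 → Fin 4
0F ⊗ b = 0F
1F ⊗ b = b
a ⊗ 0F = 0F
a ⊗ 1F = a
2F ⊗ 2F = 3F
2F ⊗ 3F = 1F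
3F ⊗ 2F = 1F
3F ⊗ 3F = 2F

𝔽₄⁺ : DecAbelianGroup
𝔽₄⁺ = finiteAbelianGroup _⊕_ 0F (λ a → a)

⊗-distribʳ-⊕ : ∀ a b c → (a ⊕ b) ⊗ c ≡ (a ⊗ c) ⊕ (b ⊗ c)
⊗-distribʳ-⊕ = from-yes (all? λ a → all? λ b → all? λ c → (a ⊕ b) ⊗ c ≟ᶠ (a ⊗ c) ⊕ (b ⊗ c))

record Hom (G H : DecAbelianGroup) : Set where
  private
    module G = DecAbelianGroup G
    module H = DecAbelianGroup H
  field
    ⟦_⟧ : G.Carrier → H.Carrier
    ∙-homo : ∀ a b → ⟦ a G.∙ b ⟧ ≡ ⟦ a ⟧ H.∙ ⟦ b ⟧

module Multiples (G : DecAbelianGroup) where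
  open DecAbelianGroup G

  ·-+ : ∀ m n g → (m + n) · g ≡ m · g ∙ n · g
  ·-+ zero n g = sym (identityˡ (n · g))
  ·-+ (suc m) n g = begin
    (m + n) · g ∙ g         ≡⟨ cong (_∙ g) (·-+ m n g) ⟩
    (m · g ∙ n · g) ∙ g     ≡⟨ xy∙z≈xz∙y (m · g) (n · g) g ⟩
    m · g ∙ g ∙ n · g       ∎
    where open ≡-Reasoning

  ·-*-ε : ∀ k g → k · g ≡ ε → ∀ q → (q * k) · g ≡ ε
  ·-*-ε k g kg≡ε zero = refl
  ·-*-ε k g kg≡ε (suc q) = trans (·-+ k (q * k) g) (trans (cong₂ _∙_ kg≡ε (·-*-ε k g kg≡ε q)) (identityˡ ε))

  ·-% : ∀ k .{{_ : NonZero k}} g → k · g ≡ ε → ∀ n → n · g ≡ (n % k) · g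
  ·-% k g kg≡ε n = begin
    n · g                                ≡⟨ cong (_· g) (m≡m%n+[m/n]*n n k) ⟩
    (n % k + (n / k) * k) · g            ≡⟨ ·-+ (n % k) ((n / k) * k) g ⟩
    (n % k) · g ∙ ((n / k) * k) · g      ≡⟨ cong ((n % k) · g ∙_) (·-*-ε k g kg≡ε (n / k)) ⟩
    (n % k) · g ∙ ε                      ≡⟨ identityʳ _ ⟩
    (n % k) · g                          ∎
    where open ≡-Reasoning

module _ {A G : DecAbelianGroup} where
  private
    module A = DecAbelianGroup A
    module G = DecAbelianGroup G
  open Multiples G

  multiplesHom : (ι : A.Carrier → ℕ) (k : ℕ) .{{_ : NonZero k}} →
    (∀ a b → ι (a A.∙ b) ≡ (ι a + ι b) % k) → (g : G.Carrier) → k G.· g ≡ G.ε → Hom A G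
  multiplesHom ι k ι-∙ g kg≡ε = record
    { ⟦_⟧ = λ a → ι a G.· g
    ; ∙-homo = λ a b → begin
        ι (a A.∙ b) G.· g            ≡⟨ cong (G._· g) (ι-∙ a b) ⟩
        ((ι a + ι b) % k) G.· g      ≡⟨ sym (·-% k g kg≡ε (ι a + ι b)) ⟩
        (ι a + ι b) G.· g            ≡⟨ ·-+ (ι a) (ι b) g ⟩
        ι a G.· g G.∙ ι b G.· g      ∎
    }
    where open ≡-Reasoning

  _+ᴴ_ : Hom A G → Hom A G → Hom A G
  φ +ᴴ ψ = record
    { ⟦_⟧ = λ a → φ.⟦ a ⟧ G.∙ ψ.⟦ a ⟧
    ; ∙-homo = λ a b → trans (cong₂ G._∙_ (φ.∙-homo a b) (ψ.∙-homo a b)) (G.interchange φ.⟦ a ⟧ φ.⟦ b ⟧ ψ.⟦ a ⟧ ψ.⟦ b ⟧)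
    }
    where
    module φ = Hom φ
    module ψ = Hom ψ

bit₀ bit₁ : Fin 4 → ℕ
bit₀ x = toℕ x % 2
bit₁ x = toℕ x / 2

module Generators (G : DecAbelianGroup) where
  open DecAbelianGroup G

  kleinHom : (a b : Carrier) → 2 · a ≡ ε → 2 · b ≡ ε → Hom 𝔽₄⁺ G
  kleinHom a b 2a≡ε 2b≡ε = multiplesHom bit₀ 2 bit₀-⊕ a 2a≡ε +ᴴ multiplesHom bit₁ 2 bit₁-⊕ b 2b≡ε
    where
    bit₀-⊕ : ∀ x y → bit₀ (x ⊕ y) ≡ (bit₀ x + bit₀ y) % 2
    bit₀-⊕ = from-yes (all? λ x → all? λ y → bit₀ (x ⊕ y) ℕ.≟ (bit₀ x + bit₀ y) % 2)
    bit₁-⊕ : ∀ x y → bit₁ (x ⊕ y) ≡ (bit₁ x + bit₁ y) % 2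
    bit₁-⊕ = from-yes (all? λ x → all? λ y → bit₁ (x ⊕ y) ℕ.≟ (bit₁ x + bit₁ y) % 2)

  cyclicHom : (g : Carrier) → 4 · g ≡ ε → Hom ℤ₄ G
  cyclicHom = multiplesHom toℕ 4 (λ a b → toℕ-fromℕ< _)

  shrikhandeHom : (P Q : Carrier) → 4 · P ≡ ε → 4 · Q ≡ ε → Hom ℤ₄² G
  shrikhandeHom P Q 4P≡ε 4Q≡ε =
    multiplesHom (λ x → toℕ (proj₁ x)) 4 (λ a b → toℕ-fromℕ< _) P 4P≡ε
    +ᴴ multiplesHom (λ x → toℕ (proj₂ x)) 4 (λ a b → toℕ-fromℕ< _) Q 4Q≡ε

-- Colourings by sums of coordinate labels

record Labelling (G : DecAbelianGroup) {X : Set} (Γ : FactorGraph X) : Set where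
  open DecAbelianGroup G
  open FactorGraph Γ
  field
    label : X → Carrier
    differences : List Carrier
    count-neighbours : ∀ x (g : Carrier → Bool) →
      count (λ y → adj x y ∧ g (label y)) vertices ≡ count (λ d → g (label x ∙ d)) differences

mapLabelling : {G H : DecAbelianGroup} {X : Set} {Γ : FactorGraph X} → Hom G H → Labelling G Γ → Labelling H Γ
mapLabelling {G} {H} {Γ = Γ} ψ ℓ = record
  { label = λ x → ⟦ label x ⟧
  ; differences = map ⟦_⟧ differences
  ; count-neighbours = λ x g → begin
      count (λ y → adj x y ∧ g ⟦ label y ⟧) vertices
    ≡⟨ count-neighbours x (λ a → g ⟦ a ⟧) ⟩
      count (λ d → g ⟦ label x G.∙ d ⟧) differences
    ≡⟨ count-cong (λ d → cong g (∙-homo (label x) d)) differences ⟩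
      count (λ d → g (⟦ label x ⟧ H.∙ ⟦ d ⟧)) differences
    ≡⟨ sym (count-map _ ⟦_⟧ differences) ⟩
      count (λ e → g (⟦ label x ⟧ H.∙ e)) (map ⟦_⟧ differences)
    ∎
  }
  where
  module G = DecAbelianGroup G
  module H = DecAbelianGroup H
  open Labelling ℓ
  open FactorGraph Γ
  open Hom ψ
  open ≡-Reasoning

module Colouring (G : DecAbelianGroup) where
  open DecAbelianGroup G
  open Labelling

  labelSum : {X : Set} {Γ : FactorGraph X} {k : ℕ} → List (Labelling G Γ) → Vec X k → Carrier
  labelSum (ℓ ∷ ℓs) (y ∷ ys) = label ℓ y ∙ labelSum ℓs ys
  labelSum _ _ = ε

  allDifferences : {X : Set} {Γ : FactorGraph X} → List (Labelling G Γ) → List Carrier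
  allDifferences = concatMap differences

  nbrCount-labelSum : {X : Set} {Γ : FactorGraph X} {k : ℕ} (ℓs : List (Labelling G Γ)) (x : Vec X k) →
    length ℓs ≡ k → ∀ c t →
    nbrCount (FactorGraph.adj Γ) (FactorGraph.vertices Γ) x (λ x′ → ⌊ labelSum ℓs x′ ∙ c ≟ t ⌋)
    ≡ count (λ d → ⌊ (labelSum ℓs x ∙ c) ∙ d ≟ t ⌋) (allDifferences ℓs)
  nbrCount-labelSum [] [] _ c t = refl
  nbrCount-labelSum {Γ = Γ} (ℓ ∷ ℓs) (y ∷ ys) len c t =
    begin
      count (λ y′ → adj y y′ ∧ ⌊ (label ℓ y′ ∙ labelSum ℓs ys) ∙ c ≟ t ⌋) vertices
      + nbrCount adj vertices ys (λ w → ⌊ (label ℓ y ∙ labelSum ℓs w) ∙ c ≟ t ⌋)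
    ≡⟨ cong₂ _+_ (count-neighbours ℓ y (λ a → ⌊ (a ∙ labelSum ℓs ys) ∙ c ≟ t ⌋))
                 (nbrCount-cong adj vertices ys (λ w → cong (λ z → ⌊ z ≟ t ⌋) (moveOut (labelSum ℓs w)))) ⟩
      count (λ d → ⌊ ((label ℓ y ∙ d) ∙ labelSum ℓs ys) ∙ c ≟ t ⌋) (differences ℓ)
      + nbrCount adj vertices ys (λ w → ⌊ labelSum ℓs w ∙ (label ℓ y ∙ c) ≟ t ⌋)
    ≡⟨ cong₂ _+_ (count-cong (λ d → cong (λ z → ⌊ z ≟ t ⌋) (moveIn d)) (differences ℓ))
                 (nbrCount-labelSum ℓs ys (suc-injective len) (label ℓ y ∙ c) t) ⟩
      count (λ d → ⌊ V ∙ d ≟ t ⌋) (differences ℓ)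
      + count (λ d → ⌊ (labelSum ℓs ys ∙ (label ℓ y ∙ c)) ∙ d ≟ t ⌋) (allDifferences ℓs)
    ≡⟨ cong (count (λ d → ⌊ V ∙ d ≟ t ⌋) (differences ℓ) +_)
            (count-cong (λ d → cong (λ z → ⌊ z ∙ d ≟ t ⌋) (sym (moveOut (labelSum ℓs ys)))) (allDifferences ℓs)) ⟩
      count (λ d → ⌊ V ∙ d ≟ t ⌋) (differences ℓ) + count (λ d → ⌊ V ∙ d ≟ t ⌋) (allDifferences ℓs)
    ≡⟨ sym (count-++ _ (differences ℓ) (allDifferences ℓs)) ⟩
      count (λ d → ⌊ V ∙ d ≟ t ⌋) (allDifferences (ℓ ∷ ℓs))
    ∎
    where
    open ≡-Reasoning
    open FactorGraph Γ
    V : Carrier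
    V = (label ℓ y ∙ labelSum ℓs ys) ∙ c
    moveOut : ∀ w → (label ℓ y ∙ w) ∙ c ≡ w ∙ (label ℓ y ∙ c)
    moveOut w = trans (cong (_∙ c) (comm (label ℓ y) w)) (assoc w (label ℓ y) c)
    moveIn : ∀ d → ((label ℓ y ∙ d) ∙ labelSum ℓs ys) ∙ c ≡ V ∙ d
    moveIn d = begin
      ((label ℓ y ∙ d) ∙ labelSum ℓs ys) ∙ c ≡⟨ cong (_∙ c) (xy∙z≈xz∙y (label ℓ y) d (labelSum ℓs ys)) ⟩
      ((label ℓ y ∙ labelSum ℓs ys) ∙ d) ∙ c ≡⟨ xy∙z≈xz∙y _ d c ⟩
      V ∙ d ∎

  covers-++ : {X : Set} {Γ : FactorGraph X} (ℓs ℓs′ : List (Labelling G Γ)) {a s a′ s′ : ℕ} →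
    Covers (allDifferences ℓs) a s → Covers (allDifferences ℓs′) a′ s′ → Covers (allDifferences (ℓs ++ ℓs′)) (a + a′) (s + s′)
  covers-++ ℓs ℓs′ {a} {s} {a′} {s′} cov cov′ z =
    trans (cong (λ ds → multiplicity ds z) (concatMap-++ differences ℓs ℓs′))
    (trans (multiplicity-++ (allDifferences ℓs) (allDifferences ℓs′) z)
    (trans (cong₂ _+_ (cov z) (cov′ z)) (if-+ ⌊ z ≟ ε ⌋)))
    where
    if-+ : ∀ x → (if x then a else s) + (if x then a′ else s′) ≡ (if x then a + a′ else s + s′)
    if-+ true = refl
    if-+ false = refl

  covers-replicate : {X : Set} {Γ : FactorGraph X} (k : ℕ) (ℓs : List (Labelling G Γ)) {a s : ℕ} →
    Covers (allDifferences ℓs) a s → Covers (allDifferences (concat (List.replicate k ℓs))) (k * a) (k * s)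
  covers-replicate zero ℓs cov z = if-0 ⌊ z ≟ ε ⌋
    where
    if-0 : ∀ x → 0 ≡ (if x then 0 else 0)
    if-0 true = refl
    if-0 false = refl
  covers-replicate (suc k) ℓs cov = covers-++ ℓs (concat (List.replicate k ℓs)) cov (covers-replicate k ℓs cov)

  copies : {A : Set} → ℕ → List A → List A
  copies k = concatMap (List.replicate k)

  multiplicity-copies : {X : Set} {Γ : FactorGraph X} (k : ℕ) (ℓs : List (Labelling G Γ)) (z : Carrier) →
    multiplicity (allDifferences (copies k ℓs)) z ≡ k * multiplicity (allDifferences ℓs) z
  multiplicity-copies k [] z = sym (*-zeroʳ k)
  multiplicity-copies k (ℓ ∷ ℓs) z = begin
      multiplicity (allDifferences (List.replicate k ℓ ++ copies k ℓs)) z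
    ≡⟨ cong (λ ds → multiplicity ds z) (concatMap-++ differences (List.replicate k ℓ) (copies k ℓs)) ⟩
      multiplicity (allDifferences (List.replicate k ℓ) ++ allDifferences (copies k ℓs)) z
    ≡⟨ multiplicity-++ (allDifferences (List.replicate k ℓ)) _ z ⟩
      multiplicity (allDifferences (List.replicate k ℓ)) z + multiplicity (allDifferences (copies k ℓs)) z
    ≡⟨ cong₂ _+_ (replicated k) (multiplicity-copies k ℓs z) ⟩
      k * multiplicity (differences ℓ) z + k * multiplicity (allDifferences ℓs) z
    ≡⟨ sym (*-distribˡ-+ k _ _) ⟩
      k * (multiplicity (differences ℓ) z + multiplicity (allDifferences ℓs) z)
    ≡⟨ cong (k *_) (sym (multiplicity-++ (differences ℓ) _ z)) ⟩
      k * multiplicity (allDifferences (ℓ ∷ ℓs)) z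
    ∎
    where
    open ≡-Reasoning
    replicated : ∀ k → multiplicity (allDifferences (List.replicate k ℓ)) z ≡ k * multiplicity (differences ℓ) z
    replicated zero = refl
    replicated (suc k) = trans (multiplicity-++ (differences ℓ) _ z) (cong (multiplicity (differences ℓ) z +_) (replicated k))

  covers-≗ : ∀ ds es {a s} → (∀ z → multiplicity ds z ≡ multiplicity es z) → Covers es a s → Covers ds a s
  covers-≗ ds es ds≗es covers z = trans (ds≗es z) (covers z)

  module SumOfLabels {m n : ℕ} (ss : List (Labelling G Shrikhande)) (ks : List (Labelling G K4))
                     (len-ss : length ss ≡ m) (len-ks : length ks ≡ n) where

    Φ : Vertex m n → Carrier
    Φ (x , u) = labelSum ss x ∙ labelSum ks u

    count-neighbours-Φ : ∀ v t →
      count (λ w → adjD v w ∧ ⌊ Φ w ≟ t ⌋) (allVertices m n) ≡ multiplicity (allDifferences ss ++ allDifferences ks) (Φ v ⁻¹ ∙ t)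
    count-neighbours-Φ (x , u) t = begin
        count (λ w → adjD (x , u) w ∧ ⌊ Φ w ≟ t ⌋) (allVertices m n)
      ≡⟨ count-adjD m n x u (λ w → ⌊ Φ w ≟ t ⌋) ⟩
        nbrCount adjShr allZ4² x (λ x′ → ⌊ labelSum ss x′ ∙ labelSum ks u ≟ t ⌋)
        + nbrCount adjK4 allZ4 u (λ u′ → ⌊ labelSum ss x ∙ labelSum ks u′ ≟ t ⌋)
      ≡⟨ cong (nbrCount adjShr allZ4² x (λ x′ → ⌊ labelSum ss x′ ∙ labelSum ks u ≟ t ⌋) +_)
              (nbrCount-cong adjK4 allZ4 u (λ u′ → cong (λ z → ⌊ z ≟ t ⌋) (comm (labelSum ss x) (labelSum ks u′)))) ⟩
        nbrCount adjShr allZ4² x (λ x′ → ⌊ labelSum ss x′ ∙ labelSum ks u ≟ t ⌋)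
        + nbrCount adjK4 allZ4 u (λ u′ → ⌊ labelSum ks u′ ∙ labelSum ss x ≟ t ⌋)
      ≡⟨ cong₂ _+_ (nbrCount-labelSum ss x len-ss (labelSum ks u) t) (nbrCount-labelSum ks u len-ks (labelSum ss x) t) ⟩
        count (λ d → ⌊ V ∙ d ≟ t ⌋) (allDifferences ss)
        + count (λ d → ⌊ (labelSum ks u ∙ labelSum ss x) ∙ d ≟ t ⌋) (allDifferences ks)
      ≡⟨ cong (count (λ d → ⌊ V ∙ d ≟ t ⌋) (allDifferences ss) +_)
              (count-cong (λ d → cong (λ z → ⌊ z ∙ d ≟ t ⌋) (comm (labelSum ks u) (labelSum ss x))) (allDifferences ks)) ⟩
        count (λ d → ⌊ V ∙ d ≟ t ⌋) (allDifferences ss) + count (λ d → ⌊ V ∙ d ≟ t ⌋) (allDifferences ks)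
      ≡⟨ sym (count-++ (λ d → ⌊ V ∙ d ≟ t ⌋) (allDifferences ss) (allDifferences ks)) ⟩
        count (λ d → ⌊ V ∙ d ≟ t ⌋) (allDifferences ss ++ allDifferences ks)
      ≡⟨ count-cong (λ d → ⌊⌋-⇔ (V ∙ d ≟ t) (d ≟ V ⁻¹ ∙ t) (y≈x\\z V d t) (λ e → trans (cong (V ∙_) e) (\\-leftDividesˡ V t)))
                    (allDifferences ss ++ allDifferences ks) ⟩
        multiplicity (allDifferences ss ++ allDifferences ks) (V ⁻¹ ∙ t)
      ∎
      where
      open ≡-Reasoning
      V : Carrier
      V = labelSum ss x ∙ labelSum ks u

  perfectColouring : ∀ {m n k s a} → Carrier ↔ Fin k →
    (ss : List (Labelling G Shrikhande)) (ks : List (Labelling G K4)) → length ss ≡ m → length ks ≡ n →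
    1 ≤ s → Covers (allDifferences ss ++ allDifferences ks) a s →
    HasPerfectColouring m n k (sJE+aE s a)
  perfectColouring {m} {n} {k} {s} {a} code ss ks len-ss len-ks 1≤s covers =
    colour , perfect⇒surjective colour 1≤s perfect , perfect
    where
    open Inverse code using (to; from; strictlyInverseˡ; strictlyInverseʳ)
    open SumOfLabels ss ks len-ss len-ks
    colour : Vertex m n → Fin k
    colour v = to (Φ v)
    perfect : ∀ v j → nbrsOfColour colour v j ≡ sJE+aE s a (colour v) j
    perfect v j = begin
        count (λ w → adjD v w ∧ ⌊ colour w ≟ᶠ j ⌋) (allVertices m n)
      ≡⟨ count-cong (λ w → cong (adjD v w ∧_) (⌊⌋-⇔ (colour w ≟ᶠ j) (Φ w ≟ from j)
            (λ e → trans (sym (strictlyInverseʳ (Φ w))) (cong from e)) (λ e → trans (cong to e) (strictlyInverseˡ j))))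
            (allVertices m n) ⟩
        count (λ w → adjD v w ∧ ⌊ Φ w ≟ from j ⌋) (allVertices m n)
      ≡⟨ count-neighbours-Φ v (from j) ⟩
        multiplicity (allDifferences ss ++ allDifferences ks) (Φ v ⁻¹ ∙ from j)
      ≡⟨ covers (Φ v ⁻¹ ∙ from j) ⟩
        (if ⌊ Φ v ⁻¹ ∙ from j ≟ ε ⌋ then a else s)
      ≡⟨ cong (λ b → if b then a else s) (⌊⌋-⇔ (Φ v ⁻¹ ∙ from j ≟ ε) (colour v ≟ᶠ j) same-colour same-colour⁻¹) ⟩
        sJE+aE s a (colour v) j
      ∎
      where
      open ≡-Reasoning
      same-colour : Φ v ⁻¹ ∙ from j ≡ ε → to (Φ v) ≡ j
      same-colour e = trans (cong to (trans (sym (identityʳ (Φ v)))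
                                    (trans (cong (Φ v ∙_) (sym e)) (\\-leftDividesˡ (Φ v) (from j)))))
                            (strictlyInverseˡ j)
      same-colour⁻¹ : to (Φ v) ≡ j → Φ v ⁻¹ ∙ from j ≡ ε
      same-colour⁻¹ e = trans (cong (Φ v ⁻¹ ∙_) (trans (sym (cong from e)) (strictlyInverseʳ (Φ v)))) (inverseˡ (Φ v))

-- Cayley graphs of abelian groups

record CayleyGraph (A : DecAbelianGroup) : Set where
  open DecAbelianGroup A
  field
    graph : FactorGraph Carrier
  open FactorGraph graph
  field
    adj-translate : ∀ x d → adj x (x ∙ d) ≡ adj ε d

  connections : List Carrier
  connections = filterᵇ (adj ε) vertices

  ∑-translate : ∀ x (f : Carrier → ℕ) → ∑ vertices f ≡ ∑[ d ∈ vertices ] f (x ∙ d)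
  ∑-translate x f = sym (begin
      ∑[ d ∈ vertices ] f (x ∙ d)
    ≡⟨ ∑-cong (λ d → sym (∑-select (x ∙ d) f)) vertices ⟩
      ∑[ d ∈ vertices ] ∑[ y ∈ vertices ] (if (x ∙ d) == y then f y else 0)
    ≡⟨ ∑-comm vertices vertices _ ⟩
      ∑[ y ∈ vertices ] ∑[ d ∈ vertices ] (if (x ∙ d) == y then f y else 0)
    ≡⟨ ∑-cong (λ y → ∑-cong (λ d → cong (λ b → if b then f y else 0) (==-solve d y)) vertices) vertices ⟩
      ∑[ y ∈ vertices ] ∑[ d ∈ vertices ] (if (x ⁻¹ ∙ y) == d then f y else 0)
    ≡⟨ ∑-cong (λ y → ∑-select (x ⁻¹ ∙ y) (λ _ → f y)) vertices ⟩
      ∑ vertices f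
    ∎)
    where
    open ≡-Reasoning
    ==-complete : ∀ {a b} → a ≡ b → (a == b) ≡ true
    ==-complete {a} refl = ==-refl a
    ==-solve : ∀ d y → ((x ∙ d) == y) ≡ ((x ⁻¹ ∙ y) == d)
    ==-solve d y = Bool-⇔ (λ e → ==-complete (sym (y≈x\\z x d y (==-sound e))))
                          (λ e → ==-complete (trans (cong (x ∙_) (sym (==-sound e))) (\\-leftDividesˡ x y)))

module _ (G : DecAbelianGroup) {A : DecAbelianGroup} (Γ : CayleyGraph A) where
  private
    module G = DecAbelianGroup G
    module A = DecAbelianGroup A
  open CayleyGraph Γ
  open FactorGraph graph

  cayleyLabelling : Hom A G → Labelling G graph
  cayleyLabelling φ = record
    { label = ⟦_⟧
    ; differences = map ⟦_⟧ connections
    ; count-neighbours = λ x g → begin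
        count (λ y → adj x y ∧ g ⟦ y ⟧) vertices
      ≡⟨ count≡∑𝟙 _ vertices ⟩
        ∑[ y ∈ vertices ] 𝟙 (adj x y ∧ g ⟦ y ⟧)
      ≡⟨ ∑-translate x _ ⟩
        ∑[ d ∈ vertices ] 𝟙 (adj x (x A.∙ d) ∧ g ⟦ x A.∙ d ⟧)
      ≡⟨ ∑-cong (λ d → cong₂ (λ b c → 𝟙 (b ∧ g c)) (adj-translate x d) (∙-homo x d)) vertices ⟩
        ∑[ d ∈ vertices ] 𝟙 (adj A.ε d ∧ g (⟦ x ⟧ G.∙ ⟦ d ⟧))
      ≡⟨ sym (count≡∑𝟙 _ vertices) ⟩
        count (λ d → adj A.ε d ∧ g (⟦ x ⟧ G.∙ ⟦ d ⟧)) vertices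
      ≡⟨ sym (count-filter _ (adj A.ε) vertices) ⟩
        count (λ d → g (⟦ x ⟧ G.∙ ⟦ d ⟧)) connections
      ≡⟨ sym (count-map _ ⟦_⟧ connections) ⟩
        count (λ e → g (⟦ x ⟧ G.∙ e)) (map ⟦_⟧ connections)
      ∎
    }
    where
    open Hom φ
    open ≡-Reasoning

K4-𝔽₄ : CayleyGraph 𝔽₄⁺
K4-𝔽₄ = record
  { graph = K4
  ; adj-translate = from-yes (all? λ x → all? λ d → adjK4 x (x ⊕ d) Bool.≟ adjK4 0F d) }

K4-ℤ₄ : CayleyGraph ℤ₄
K4-ℤ₄ = record
  { graph = K4
  ; adj-translate = from-yes (all? λ x → all? λ d → adjK4 x (x ∙ d) Bool.≟ adjK4 0F d) }
  where open DecAbelianGroup ℤ₄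

Shrikhande-ℤ₄² : CayleyGraph ℤ₄²
Shrikhande-ℤ₄² = record
  { graph = Shrikhande
  ; adj-translate = λ (x₁ , x₂) (d₁ , d₂) → translate x₁ x₂ d₁ d₂ }
  where
  open DecAbelianGroup ℤ₄²
  translate : ∀ x₁ x₂ d₁ d₂ → adjShr (x₁ , x₂) ((x₁ , x₂) ∙ (d₁ , d₂)) ≡ adjShr ε (d₁ , d₂)
  translate = from-yes (all? λ x₁ → all? λ x₂ → all? λ d₁ → all? λ d₂ →
    adjShr (x₁ , x₂) ((x₁ , x₂) ∙ (d₁ , d₂)) Bool.≟ adjShr ε (d₁ , d₂))

module Coordinates (G : DecAbelianGroup) where
  open DecAbelianGroup G
  open Generators G

  lineCoordinate : (a b : Carrier) → 2 · a ≡ ε → 2 · b ≡ ε → Labelling G K4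
  lineCoordinate a b 2a≡ε 2b≡ε = cayleyLabelling G K4-𝔽₄ (kleinHom a b 2a≡ε 2b≡ε)

  cyclicCoordinate : (g : Carrier) → 4 · g ≡ ε → Labelling G K4
  cyclicCoordinate g 4g≡ε = cayleyLabelling G K4-ℤ₄ (cyclicHom g 4g≡ε)

  shrikhandeCoordinate : (P Q : Carrier) → 4 · P ≡ ε → 4 · Q ≡ ε → Labelling G Shrikhande
  shrikhandeCoordinate P Q 4P≡ε 4Q≡ε = cayleyLabelling G Shrikhande-ℤ₄² (shrikhandeHom P Q 4P≡ε 4Q≡ε)

  2·≡ε⇒4·≡ε : ∀ g → 2 · g ≡ ε → 4 · g ≡ ε
  2·≡ε⇒4·≡ε g 2g≡ε = trans (Multiples.·-+ G 2 2 g) (trans (cong₂ _∙_ 2g≡ε 2g≡ε) (identityˡ ε))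

  -- Where 2P = 2Q = ε, the six Shrikhande neighbours of 0 are labelled Q, Q, P, P + Q, P, P + Q.
  shrikhande≈2×line : ∀ P Q (2P≡ε : 2 · P ≡ ε) (2Q≡ε : 2 · Q ≡ ε) (g : Carrier → Bool) →
    count g (Labelling.differences (shrikhandeCoordinate P Q (2·≡ε⇒4·≡ε P 2P≡ε) (2·≡ε⇒4·≡ε Q 2Q≡ε)))
    ≡ 2 * count g (Labelling.differences (lineCoordinate P Q 2P≡ε 2Q≡ε))
  shrikhande≈2×line P Q 2P≡ε 2Q≡ε g = begin
      count g (0 · P ∙ 1 · Q ∷ 0 · P ∙ 3 · Q ∷ 1 · P ∙ 0 · Q ∷ 1 · P ∙ 1 · Q ∷ 3 · P ∙ 0 · Q ∷ 3 · P ∙ 3 · Q ∷ [])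
    ≡⟨ cong₂ (λ P′ Q′ → count g (0 · P ∙ 1 · Q ∷ 0 · P ∙ Q′ ∷ 1 · P ∙ 0 · Q ∷ 1 · P ∙ 1 · Q ∷ P′ ∙ 0 · Q ∷ P′ ∙ Q′ ∷ []))
             (cong (_∙ P) 2P≡ε) (cong (_∙ Q) 2Q≡ε) ⟩
      count g (L₂ ∷ L₂ ∷ L₁ ∷ L₃ ∷ L₁ ∷ L₃ ∷ [])
    ≡⟨ count≡∑𝟙 g (L₂ ∷ L₂ ∷ L₁ ∷ L₃ ∷ L₁ ∷ L₃ ∷ []) ⟩
      𝟙 (g L₂) + (𝟙 (g L₂) + (𝟙 (g L₁) + (𝟙 (g L₃) + (𝟙 (g L₁) + (𝟙 (g L₃) + 0)))))
    ≡⟨ twice (𝟙 (g L₁)) (𝟙 (g L₂)) (𝟙 (g L₃)) ⟩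
      2 * (𝟙 (g L₁) + (𝟙 (g L₂) + (𝟙 (g L₃) + 0)))
    ≡⟨ cong (2 *_) (sym (count≡∑𝟙 g (L₁ ∷ L₂ ∷ L₃ ∷ []))) ⟩
      2 * count g (L₁ ∷ L₂ ∷ L₃ ∷ [])
    ∎
    where
    open ≡-Reasoning
    L₁ L₂ L₃ : Carrier
    L₁ = 1 · P ∙ 0 · Q
    L₂ = 0 · P ∙ 1 · Q
    L₃ = 1 · P ∙ 1 · Q
    twice : ∀ a b c → b + (b + (a + (c + (a + (c + 0))))) ≡ 2 * (a + (b + (c + 0)))
    twice = solve-∀

-- Lines through the origin of GF(4)ʳ

𝔽₄ᵛ : ℕ → DecAbelianGroup
𝔽₄ᵛ r = 𝔽₄⁺ ^ᴳ r

infixr 8 _⋆_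
infix 4 _≟ᵛ_

_⋆_ : ∀ {r} → Fin 4 → Vec (Fin 4) r → Vec (Fin 4) r
α ⋆ v = Data.Vec.map (α ⊗_) v

_≟ᵛ_ : ∀ {r} → DecidableEquality (Vec (Fin 4) r)
_≟ᵛ_ = DecAbelianGroup._≟_ (𝔽₄ᵛ _)

scalarHom : ∀ {r} → Vec (Fin 4) r → Hom 𝔽₄⁺ (𝔽₄ᵛ r)
scalarHom v = record { ⟦_⟧ = _⋆ v ; ∙-homo = λ a b → ⋆-distrib a b v }
  where
  ⋆-distrib : ∀ {r} a b (v : Vec (Fin 4) r) → (a ⊕ b) ⋆ v ≡ zipWith _⊕_ (a ⋆ v) (b ⋆ v)
  ⋆-distrib a b [] = refl
  ⋆-distrib a b (x ∷ v) = cong₂ _∷_ (⊗-distribʳ-⊕ a b x) (⋆-distrib a b v)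

-- One representative per line: the first nonzero coordinate is 1.
projectivePoints : (r : ℕ) → List (Vec (Fin 4) r)
projectivePoints zero = []
projectivePoints (suc r) = map (1F ∷_) (allVecs allZ4 r) ++ map (0F ∷_) (projectivePoints r)

⌊≟ᵛ⌋-∷ : ∀ {r} x y (v w : Vec (Fin 4) r) → ⌊ (x ∷ v) ≟ᵛ (y ∷ w) ⌋ ≡ ⌊ x ≟ᶠ y ⌋ ∧ ⌊ v ≟ᵛ w ⌋
⌊≟ᵛ⌋-∷ x y v w = trans (isYes≗does ((x ∷ v) ≟ᵛ (y ∷ w))) (sym (cong₂ _∧_ (isYes≗does (x ≟ᶠ y)) (isYes≗does (v ≟ᵛ w))))

⋆-bijective : ∀ r α → α ≢ 0F → (b : Vec (Fin 4) r) → count (λ w → ⌊ α ⋆ w ≟ᵛ b ⌋) (allVecs allZ4 r) ≡ 1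
⋆-bijective zero α α≢0 [] = refl
⋆-bijective (suc r) α α≢0 (b ∷ bs) = begin
    count (λ w → ⌊ α ⋆ w ≟ᵛ (b ∷ bs) ⌋) (allVecs allZ4 (suc r))
  ≡⟨ count-concatMap (λ w → ⌊ α ⋆ w ≟ᵛ (b ∷ bs) ⌋) (λ y → map (y ∷_) (allVecs allZ4 r)) allZ4 ⟩
    ∑[ y ∈ allZ4 ] count (λ w → ⌊ α ⋆ w ≟ᵛ (b ∷ bs) ⌋) (map (y ∷_) (allVecs allZ4 r))
  ≡⟨ ∑-cong (λ y → trans (count-map (λ w → ⌊ α ⋆ w ≟ᵛ (b ∷ bs) ⌋) (y ∷_) (allVecs allZ4 r)) (trans
       (count-cong (λ w → ⌊≟ᵛ⌋-∷ (α ⊗ y) b (α ⋆ w) bs) (allVecs allZ4 r))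
       (count-∧ˡ ⌊ α ⊗ y ≟ᶠ b ⌋ (λ w → ⌊ α ⋆ w ≟ᵛ bs ⌋) (allVecs allZ4 r)))) allZ4 ⟩
    ∑[ y ∈ allZ4 ] (if ⌊ α ⊗ y ≟ᶠ b ⌋ then count (λ w → ⌊ α ⋆ w ≟ᵛ bs ⌋) (allVecs allZ4 r) else 0)
  ≡⟨ ∑-cong (λ y → cong (λ n → if ⌊ α ⊗ y ≟ᶠ b ⌋ then n else 0) (⋆-bijective r α α≢0 bs)) allZ4 ⟩
    ∑[ y ∈ allZ4 ] 𝟙 ⌊ α ⊗ y ≟ᶠ b ⌋
  ≡⟨ sym (count≡∑𝟙 (λ y → ⌊ α ⊗ y ≟ᶠ b ⌋) allZ4) ⟩
    count (λ y → ⌊ α ⊗ y ≟ᶠ b ⌋) allZ4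
  ≡⟨ ⊗-bijective α b α≢0 ⟩
    1
  ∎
  where
  open ≡-Reasoning
  ⊗-bijective : ∀ α b → α ≢ 0F → count (λ y → ⌊ α ⊗ y ≟ᶠ b ⌋) allZ4 ≡ 1
  ⊗-bijective = from-yes (all? λ α → all? λ b → ¬? (α ≟ᶠ 0F) →-dec count (λ y → ⌊ α ⊗ y ≟ᶠ b ⌋) allZ4 ℕ.≟ 1)

𝔽₄ˣ : List (Fin 4)
𝔽₄ˣ = 1F ∷ 2F ∷ 3F ∷ []

scaledTo : (r : ℕ) → Fin 4 → Vec (Fin 4) r → ℕ
scaledTo r α b = count (λ h → ⌊ α ⋆ h ≟ᵛ b ⌋) (projectivePoints r)

scaledTo-∷ : ∀ r α → α ≢ 0F → ∀ b (bs : Vec (Fin 4) r) →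
  scaledTo (suc r) α (b ∷ bs) ≡ 𝟙 ⌊ α ⊗ 1F ≟ᶠ b ⌋ + (if ⌊ 0F ≟ᶠ b ⌋ then scaledTo r α bs else 0)
scaledTo-∷ r α α≢0 b bs =
  trans (count-++ _ (map (1F ∷_) (allVecs allZ4 r)) (map (0F ∷_) (projectivePoints r)))
        (cong₂ _+_ leading-one leading-zero)
  where
  leading-one : count (λ h → ⌊ α ⋆ h ≟ᵛ b ∷ bs ⌋) (map (1F ∷_) (allVecs allZ4 r)) ≡ 𝟙 ⌊ α ⊗ 1F ≟ᶠ b ⌋
  leading-one =
    trans (count-map (λ h → ⌊ α ⋆ h ≟ᵛ b ∷ bs ⌋) (1F ∷_) (allVecs allZ4 r))
    (trans (count-cong (λ w → ⌊≟ᵛ⌋-∷ (α ⊗ 1F) b (α ⋆ w) bs) (allVecs allZ4 r))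
    (trans (count-∧ˡ ⌊ α ⊗ 1F ≟ᶠ b ⌋ (λ w → ⌊ α ⋆ w ≟ᵛ bs ⌋) (allVecs allZ4 r))
           (cong (λ n → if ⌊ α ⊗ 1F ≟ᶠ b ⌋ then n else 0) (⋆-bijective r α α≢0 bs))))
  leading-zero : count (λ h → ⌊ α ⋆ h ≟ᵛ b ∷ bs ⌋) (map (0F ∷_) (projectivePoints r))
               ≡ (if ⌊ 0F ≟ᶠ b ⌋ then scaledTo r α bs else 0)
  leading-zero =
    trans (count-map (λ h → ⌊ α ⋆ h ≟ᵛ b ∷ bs ⌋) (0F ∷_) (projectivePoints r))
    (trans (count-cong (λ w → trans (⌊≟ᵛ⌋-∷ (α ⊗ 0F) b (α ⋆ w) bs)
                                    (cong (λ c → ⌊ c ≟ᶠ b ⌋ ∧ ⌊ α ⋆ w ≟ᵛ bs ⌋) (⊗-zeroʳ α))) (projectivePoints r))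
           (count-∧ˡ ⌊ 0F ≟ᶠ b ⌋ (λ w → ⌊ α ⋆ w ≟ᵛ bs ⌋) (projectivePoints r)))
    where
    ⊗-zeroʳ : ∀ a → a ⊗ 0F ≡ 0F
    ⊗-zeroʳ = from-yes (all? λ a → a ⊗ 0F ≟ᶠ 0F)

∑-scaledTo : ∀ r (b : Vec (Fin 4) r) → ∑[ α ∈ 𝔽₄ˣ ] scaledTo r α b ≡ (if ⌊ b ≟ᵛ replicate r 0F ⌋ then 0 else 1)
∑-scaledTo zero [] = refl
∑-scaledTo (suc r) (b ∷ bs)
  rewrite scaledTo-∷ r 1F (λ ()) b bs | scaledTo-∷ r 2F (λ ()) b bs | scaledTo-∷ r 3F (λ ()) b bs
        | ⌊≟ᵛ⌋-∷ b 0F bs (replicate r 0F) with b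
... | 0F = ∑-scaledTo r bs
... | 1F = refl
... | 2F = refl
... | 3F = refl

#projectivePoints : ∀ r → 3 * length (projectivePoints r) + 1 ≡ 4 ^ r
#projectivePoints zero = refl
#projectivePoints (suc r) = begin
    3 * length (projectivePoints (suc r)) + 1
  ≡⟨ cong (λ n → 3 * n + 1) (trans (length-++ (map (1F ∷_) (allVecs allZ4 r)))
       (cong₂ _+_ (trans (length-map (1F ∷_) (allVecs allZ4 r)) (length-allVecs r)) (length-map (0F ∷_) (projectivePoints r)))) ⟩
    3 * (4 ^ r + length (projectivePoints r)) + 1
  ≡⟨ regroup (4 ^ r) (length (projectivePoints r)) ⟩
    3 * 4 ^ r + (3 * length (projectivePoints r) + 1)
  ≡⟨ cong (3 * 4 ^ r +_) (#projectivePoints r) ⟩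
    3 * 4 ^ r + 4 ^ r
  ≡⟨ +-comm (3 * 4 ^ r) (4 ^ r) ⟩
    4 ^ suc r
  ∎
  where
  open ≡-Reasoning
  regroup : ∀ a b → 3 * (a + b) + 1 ≡ 3 * a + (3 * b + 1)
  regroup = solve-∀

module Lifting (C : DecAbelianGroup) (r : ℕ) where
  private
    module C = DecAbelianGroup C
  module B = DecAbelianGroup (C ×ᴳ 𝔽₄⁺)
  module Gᵣ = DecAbelianGroup (C ×ᴳ 𝔽₄ᵛ r)

  liftHom : Vec (Fin 4) r → Hom (C ×ᴳ 𝔽₄⁺) (C ×ᴳ 𝔽₄ᵛ r)
  liftHom h = record
    { ⟦_⟧ = λ (c , α) → (c , α ⋆ h)
    ; ∙-homo = λ (c , α) (c′ , α′) → cong (c C.∙ c′ ,_) (Hom.∙-homo (scalarHom h) α α′) }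

  embedHom : Hom C (C ×ᴳ 𝔽₄ᵛ r)
  embedHom = record
    { ⟦_⟧ = λ c → (c , replicate r 0F)
    ; ∙-homo = λ c c′ → cong (c C.∙ c′ ,_) (sym (Vec.zipWith-identityˡ (λ _ → refl) (replicate r 0F))) }

  lifted : List B.Carrier → List Gᵣ.Carrier
  lifted T = concatMap (λ h → map (Hom.⟦ liftHom h ⟧) T) (projectivePoints r)

  LineTable : List B.Carrier → ℕ → Set
  LineTable T λ′ = ∀ u α → B.multiplicity T (u , α) ≡ (if ⌊ α ≟ᶠ 0F ⌋ then 0 else λ′)

  lineTable-++ : ∀ T T′ {λ′ λ″} → LineTable T λ′ → LineTable T′ λ″ → LineTable (T ++ T′) (λ′ + λ″)
  lineTable-++ T T′ {λ′} {λ″} table table′ u α =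
    trans (B.multiplicity-++ T T′ (u , α)) (trans (cong₂ _+_ (table u α) (table′ u α)) (if-+ ⌊ α ≟ᶠ 0F ⌋))
    where
    if-+ : ∀ x → (if x then 0 else λ′) + (if x then 0 else λ″) ≡ (if x then 0 else λ′ + λ″)
    if-+ true = refl
    if-+ false = refl

  lineTable-[] : LineTable [] 0
  lineTable-[] u α with ⌊ α ≟ᶠ 0F ⌋
  ... | true = refl
  ... | false = refl

  multiplicity-lifted≡∑ : ∀ T u b →
    Gᵣ.multiplicity (lifted T) (u , b) ≡ ∑[ β ∈ allZ4 ] (scaledTo r β b * B.multiplicity T (u , β))
  multiplicity-lifted≡∑ T u b = begin
      Gᵣ.multiplicity (lifted T) (u , b)
    ≡⟨ count-concatMap (λ d → ⌊ d Gᵣ.≟ (u , b) ⌋) (λ h → map (Hom.⟦ liftHom h ⟧) T) (projectivePoints r) ⟩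
      ∑[ h ∈ projectivePoints r ] Gᵣ.multiplicity (map (Hom.⟦ liftHom h ⟧) T) (u , b)
    ≡⟨ ∑-cong (λ h → trans (count-map (λ d → ⌊ d Gᵣ.≟ (u , b) ⌋) (Hom.⟦ liftHom h ⟧) T)
         (trans (count≡∑𝟙 (λ t → ⌊ Hom.⟦ liftHom h ⟧ t Gᵣ.≟ (u , b) ⌋) T)
         (∑-cong (λ (c , α) → trans (cong 𝟙 (⌊≟⌋-×ᴳ C (𝔽₄ᵛ r) c (α ⋆ h) u b)) (𝟙-∧ ⌊ c C.≟ u ⌋ ⌊ α ⋆ h ≟ᵛ b ⌋)) T)))
         (projectivePoints r) ⟩
      ∑[ h ∈ projectivePoints r ] ∑[ t ∈ T ] (𝟙 ⌊ proj₁ t C.≟ u ⌋ * 𝟙 ⌊ proj₂ t ⋆ h ≟ᵛ b ⌋)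
    ≡⟨ ∑-comm (projectivePoints r) T (λ h t → 𝟙 ⌊ proj₁ t C.≟ u ⌋ * 𝟙 ⌊ proj₂ t ⋆ h ≟ᵛ b ⌋) ⟩
      ∑[ t ∈ T ] ∑[ h ∈ projectivePoints r ] (𝟙 ⌊ proj₁ t C.≟ u ⌋ * 𝟙 ⌊ proj₂ t ⋆ h ≟ᵛ b ⌋)
    ≡⟨ ∑-cong (λ t → trans (∑-*ˡ (𝟙 ⌊ proj₁ t C.≟ u ⌋) (projectivePoints r) (λ h → 𝟙 ⌊ proj₂ t ⋆ h ≟ᵛ b ⌋))
                           (cong (𝟙 ⌊ proj₁ t C.≟ u ⌋ *_) (sym (count≡∑𝟙 (λ h → ⌊ proj₂ t ⋆ h ≟ᵛ b ⌋) (projectivePoints r))))) T ⟩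
      ∑[ t ∈ T ] (𝟙 ⌊ proj₁ t C.≟ u ⌋ * scaledTo r (proj₂ t) b)
    ≡⟨ ∑-cong (λ t → split (proj₁ t) (proj₂ t)) T ⟩
      ∑[ t ∈ T ] ∑[ β ∈ allZ4 ] (𝟙 ⌊ t B.≟ (u , β) ⌋ * scaledTo r β b)
    ≡⟨ ∑-comm T allZ4 (λ t β → 𝟙 ⌊ t B.≟ (u , β) ⌋ * scaledTo r β b) ⟩
      ∑[ β ∈ allZ4 ] ∑[ t ∈ T ] (𝟙 ⌊ t B.≟ (u , β) ⌋ * scaledTo r β b)
    ≡⟨ ∑-cong (λ β → trans (∑-cong (λ t → *-comm (𝟙 ⌊ t B.≟ (u , β) ⌋) (scaledTo r β b)) T)
         (trans (∑-*ˡ (scaledTo r β b) T (λ t → 𝟙 ⌊ t B.≟ (u , β) ⌋))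
                (cong (scaledTo r β b *_) (sym (count≡∑𝟙 (λ t → ⌊ t B.≟ (u , β) ⌋) T))))) allZ4 ⟩
      ∑[ β ∈ allZ4 ] (scaledTo r β b * B.multiplicity T (u , β))
    ∎
    where
    open ≡-Reasoning
    𝟙-∧ : ∀ x y → 𝟙 (x ∧ y) ≡ 𝟙 x * 𝟙 y
    𝟙-∧ true y = sym (+-identityʳ (𝟙 y))
    𝟙-∧ false y = refl
    split : ∀ c α → 𝟙 ⌊ c C.≟ u ⌋ * scaledTo r α b ≡ ∑[ β ∈ allZ4 ] (𝟙 ⌊ (c , α) B.≟ (u , β) ⌋ * scaledTo r β b)
    split c α = trans (select ⌊ c C.≟ u ⌋ α)
      (∑-cong (λ β → cong (λ x → 𝟙 x * scaledTo r β b) (sym (⌊≟⌋-×ᴳ C 𝔽₄⁺ c α u β))) allZ4)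
      where
      select : ∀ x α → 𝟙 x * scaledTo r α b ≡ ∑[ β ∈ allZ4 ] (𝟙 (x ∧ ⌊ α ≟ᶠ β ⌋) * scaledTo r β b)
      select false α = refl
      select true 0F = sym (+-identityʳ _)
      select true 1F = sym (+-identityʳ _)
      select true 2F = sym (+-identityʳ _)
      select true 3F = sym (+-identityʳ _)

  multiplicity-lifted : ∀ T λ′ → LineTable T λ′ →
    ∀ u b → Gᵣ.multiplicity (lifted T) (u , b) ≡ (if ⌊ b ≟ᵛ replicate r 0F ⌋ then 0 else λ′)
  multiplicity-lifted T λ′ table u b = begin
      Gᵣ.multiplicity (lifted T) (u , b)
    ≡⟨ multiplicity-lifted≡∑ T u b ⟩
      ∑[ β ∈ allZ4 ] (scaledTo r β b * B.multiplicity T (u , β))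
    ≡⟨ ∑-cong (λ β → cong (scaledTo r β b *_) (table u β)) allZ4 ⟩
      ∑[ β ∈ allZ4 ] (scaledTo r β b * (if ⌊ β ≟ᶠ 0F ⌋ then 0 else λ′))
    ≡⟨ collect (scaledTo r 0F b) (scaledTo r 1F b) (scaledTo r 2F b) (scaledTo r 3F b) λ′ ⟩
      (∑[ α ∈ 𝔽₄ˣ ] scaledTo r α b) * λ′
    ≡⟨ cong (_* λ′) (∑-scaledTo r b) ⟩
      (if ⌊ b ≟ᵛ replicate r 0F ⌋ then 0 else 1) * λ′
    ≡⟨ if-* ⌊ b ≟ᵛ replicate r 0F ⌋ ⟩
      (if ⌊ b ≟ᵛ replicate r 0F ⌋ then 0 else λ′)
    ∎
    where
    open ≡-Reasoning
    collect : ∀ a₀ a₁ a₂ a₃ l → a₀ * 0 + (a₁ * l + (a₂ * l + (a₃ * l + 0))) ≡ (a₁ + (a₂ + (a₃ + 0))) * l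
    collect = solve-∀
    if-* : ∀ x → (if x then 0 else 1) * λ′ ≡ (if x then 0 else λ′)
    if-* true = refl
    if-* false = +-identityʳ λ′

  CoversOffAxis : List Gᵣ.Carrier → ℕ → Set
  CoversOffAxis L λ′ = ∀ u b → Gᵣ.multiplicity L (u , b) ≡ (if ⌊ b ≟ᵛ replicate r 0F ⌋ then 0 else λ′)

  multiplicity-embedded : ∀ cs u b →
    Gᵣ.multiplicity (map (Hom.⟦ embedHom ⟧) cs) (u , b) ≡ (if ⌊ b ≟ᵛ replicate r 0F ⌋ then C.multiplicity cs u else 0)
  multiplicity-embedded cs u b =
    trans (count-map (λ d → ⌊ d Gᵣ.≟ (u , b) ⌋) (Hom.⟦ embedHom ⟧) cs)
    (trans (count-cong (λ c → trans (⌊≟⌋-×ᴳ C (𝔽₄ᵛ r) c (replicate r 0F) u b)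
                       (trans (Bool.∧-comm ⌊ c C.≟ u ⌋ _)
                              (cong (_∧ ⌊ c C.≟ u ⌋) (⌊⌋-⇔ (replicate r 0F ≟ᵛ b) (b ≟ᵛ replicate r 0F) sym sym)))) cs)
           (count-∧ˡ ⌊ b ≟ᵛ replicate r 0F ⌋ (λ c → ⌊ c C.≟ u ⌋) cs))

  covers-offAxis-++-embedded : ∀ L cs {a λ′} → CoversOffAxis L λ′ → C.Covers cs a λ′ →
    Gᵣ.Covers (L ++ map (Hom.⟦ embedHom ⟧) cs) a λ′
  covers-offAxis-++-embedded L cs {a} {λ′} offAxis covers (u , b) = begin
      Gᵣ.multiplicity (L ++ map (Hom.⟦ embedHom ⟧) cs) (u , b)
    ≡⟨ Gᵣ.multiplicity-++ L _ (u , b) ⟩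
      Gᵣ.multiplicity L (u , b) + Gᵣ.multiplicity (map (Hom.⟦ embedHom ⟧) cs) (u , b)
    ≡⟨ cong₂ _+_ (offAxis u b) (trans (multiplicity-embedded cs u b)
                                     (cong (λ n → if ⌊ b ≟ᵛ replicate r 0F ⌋ then n else 0) (covers u))) ⟩
      (if ⌊ b ≟ᵛ replicate r 0F ⌋ then 0 else λ′) + (if ⌊ b ≟ᵛ replicate r 0F ⌋ then (if ⌊ u C.≟ C.ε ⌋ then a else λ′) else 0)
    ≡⟨ combine ⌊ u C.≟ C.ε ⌋ ⌊ b ≟ᵛ replicate r 0F ⌋ ⟩
      (if ⌊ u C.≟ C.ε ⌋ ∧ ⌊ b ≟ᵛ replicate r 0F ⌋ then a else λ′)
    ≡⟨ cong (λ x → if x then a else λ′) (sym (⌊≟⌋-×ᴳ C (𝔽₄ᵛ r) u b C.ε (replicate r 0F))) ⟩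
      (if ⌊ (u , b) Gᵣ.≟ Gᵣ.ε ⌋ then a else λ′)
    ∎
    where
    open ≡-Reasoning
    combine : ∀ x y → (if y then 0 else λ′) + (if y then (if x then a else λ′) else 0) ≡ (if x ∧ y then a else λ′)
    combine true true = refl
    combine false true = refl
    combine true false = +-identityʳ λ′
    combine false false = +-identityʳ λ′

  module _ {X : Set} {Γ : FactorGraph X} where
    open Colouring using (allDifferences)

    liftAll : List (Labelling (C ×ᴳ 𝔽₄⁺) Γ) → List (Labelling (C ×ᴳ 𝔽₄ᵛ r) Γ)
    liftAll ℓs = concatMap (λ h → map (mapLabelling (liftHom h)) ℓs) (projectivePoints r)

    embedAll : List (Labelling C Γ) → List (Labelling (C ×ᴳ 𝔽₄ᵛ r) Γ)
    embedAll = map (mapLabelling embedHom)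

    length-assembled : (ℓsB : List (Labelling (C ×ᴳ 𝔽₄⁺) Γ)) (ℓsC : List (Labelling C Γ)) →
      length (liftAll ℓsB ++ embedAll ℓsC) ≡ length (projectivePoints r) * length ℓsB + length ℓsC
    length-assembled ℓsB ℓsC =
      trans (length-++ (liftAll ℓsB))
            (cong₂ _+_ (length-concatMap (length ℓsB) _ (λ h → length-map _ ℓsB) (projectivePoints r)) (length-map _ ℓsC))

    allDifferences-map : {H K : DecAbelianGroup} (ψ : Hom H K) (ℓs : List (Labelling H Γ)) →
      allDifferences K (map (mapLabelling ψ) ℓs) ≡ map (Hom.⟦ ψ ⟧) (allDifferences H ℓs)
    allDifferences-map ψ ℓs =
      trans (Data.List.Properties.concatMap-map Labelling.differences (mapLabelling ψ) ℓs)
            (sym (Data.List.Properties.map-concatMap (Hom.⟦ ψ ⟧) Labelling.differences ℓs))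

    allDifferences-liftAll : ∀ ℓs → allDifferences (C ×ᴳ 𝔽₄ᵛ r) (liftAll ℓs) ≡ lifted (allDifferences (C ×ᴳ 𝔽₄⁺) ℓs)
    allDifferences-liftAll ℓs =
      trans (concatMap-concatMap Labelling.differences (λ h → map (mapLabelling (liftHom h)) ℓs) (projectivePoints r))
            (concatMap-cong (λ h → allDifferences-map (liftHom h) ℓs) (projectivePoints r))

  allDifferences-assembled : {X : Set} {Γ : FactorGraph X} (ℓsB : List (Labelling (C ×ᴳ 𝔽₄⁺) Γ)) (ℓsC : List (Labelling C Γ)) →
    Colouring.allDifferences _ (liftAll ℓsB ++ embedAll ℓsC)
    ≡ lifted (Colouring.allDifferences _ ℓsB) ++ map (Hom.⟦ embedHom ⟧) (Colouring.allDifferences C ℓsC)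
  allDifferences-assembled ℓsB ℓsC = trans (concatMap-++ Labelling.differences (liftAll ℓsB) (embedAll ℓsC))
                                           (cong₂ _++_ (allDifferences-liftAll ℓsB) (allDifferences-map embedHom ℓsC))

  multiplicity-lifted-++ : ∀ X Y z → Gᵣ.multiplicity (lifted (X ++ Y)) z ≡ Gᵣ.multiplicity (lifted X) z + Gᵣ.multiplicity (lifted Y) z
  multiplicity-lifted-++ X Y z =
    trans (count-concatMap _ (λ h → map (Hom.⟦ liftHom h ⟧) (X ++ Y)) (projectivePoints r))
    (trans (∑-cong (λ h → trans (cong (λ ds → Gᵣ.multiplicity ds z) (Data.List.Properties.map-++ (Hom.⟦ liftHom h ⟧) X Y))
                                (Gᵣ.multiplicity-++ (map (Hom.⟦ liftHom h ⟧) X) _ z)) (projectivePoints r))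
    (trans (∑-+ (projectivePoints r) _ _)
           (sym (cong₂ _+_ (count-concatMap _ (λ h → map (Hom.⟦ liftHom h ⟧) X) (projectivePoints r))
                           (count-concatMap _ (λ h → map (Hom.⟦ liftHom h ⟧) Y) (projectivePoints r))))))

  covers-assembled : (ssB : List (Labelling (C ×ᴳ 𝔽₄⁺) Shrikhande)) (ksB : List (Labelling (C ×ᴳ 𝔽₄⁺) K4))
    (ssC : List (Labelling C Shrikhande)) (ksC : List (Labelling C K4)) {a λs λk : ℕ} →
    LineTable (Colouring.allDifferences _ ssB) λs → LineTable (Colouring.allDifferences _ ksB) λk →
    C.Covers (Colouring.allDifferences C ssC ++ Colouring.allDifferences C ksC) a (λs + λk) →
    Gᵣ.Covers (Colouring.allDifferences _ (liftAll ssB ++ embedAll ssC) ++ Colouring.allDifferences _ (liftAll ksB ++ embedAll ksC))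
              a (λs + λk)
  covers-assembled ssB ksB ssC ksC {a} {λs} {λk} tableˢ tableᵏ covers z = begin
      m (Colouring.allDifferences _ (liftAll ssB ++ embedAll ssC) ++ Colouring.allDifferences _ (liftAll ksB ++ embedAll ksC))
    ≡⟨ cong m (cong₂ _++_ (allDifferences-assembled ssB ssC) (allDifferences-assembled ksB ksC)) ⟩
      m ((lifted DsB ++ ι DsC) ++ (lifted DkB ++ ι DkC))
    ≡⟨ trans (Gᵣ.multiplicity-++ (lifted DsB ++ ι DsC) (lifted DkB ++ ι DkC) z)
             (cong₂ _+_ (Gᵣ.multiplicity-++ (lifted DsB) (ι DsC) z) (Gᵣ.multiplicity-++ (lifted DkB) (ι DkC) z)) ⟩
      (m (lifted DsB) + m (ι DsC)) + (m (lifted DkB) + m (ι DkC))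
    ≡⟨ +-interchange (m (lifted DsB)) (m (ι DsC)) (m (lifted DkB)) (m (ι DkC)) ⟩
      (m (lifted DsB) + m (lifted DkB)) + (m (ι DsC) + m (ι DkC))
    ≡⟨ sym (cong₂ _+_ (multiplicity-lifted-++ DsB DkB z)
             (trans (cong m (Data.List.Properties.map-++ (Hom.⟦ embedHom ⟧) DsC DkC)) (Gᵣ.multiplicity-++ (ι DsC) (ι DkC) z))) ⟩
      m (lifted (DsB ++ DkB)) + m (ι (DsC ++ DkC))
    ≡⟨ sym (Gᵣ.multiplicity-++ (lifted (DsB ++ DkB)) (ι (DsC ++ DkC)) z) ⟩
      m (lifted (DsB ++ DkB) ++ ι (DsC ++ DkC))
    ≡⟨ covers-offAxis-++-embedded (lifted (DsB ++ DkB)) (DsC ++ DkC)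
         (multiplicity-lifted (DsB ++ DkB) (λs + λk) (lineTable-++ DsB DkB tableˢ tableᵏ)) covers z ⟩
      (if ⌊ z Gᵣ.≟ Gᵣ.ε ⌋ then a else λs + λk)
    ∎
    where
    open ≡-Reasoning
    ι : List C.Carrier → List Gᵣ.Carrier
    ι = map (Hom.⟦ embedHom ⟧)
    m : List Gᵣ.Carrier → ℕ
    m ds = Gᵣ.multiplicity ds z
    DsB DkB : List B.Carrier
    DsB = Colouring.allDifferences _ ssB
    DkB = Colouring.allDifferences _ ksB
    DsC DkC : List C.Carrier
    DsC = Colouring.allDifferences C ssC
    DkC = Colouring.allDifferences C ksC

Vec-∷↔ : {A : Set} {n : ℕ} → Vec A (suc n) ↔ (A × Vec A n)
Vec-∷↔ = mk↔ₛ′ Data.Vec.uncons (λ (x , xs) → x ∷ xs) (λ _ → refl) (λ { (x ∷ xs) → refl })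

Vec↔Fin : ∀ r → Vec (Fin 4) r ↔ Fin (4 ^ r)
Vec↔Fin zero = mk↔ₛ′ (λ _ → 0F) (λ _ → []) (λ { 0F → refl }) (λ { [] → refl })
Vec↔Fin (suc r) = ↔-trans Vec-∷↔ (↔-trans (↔-refl ×-↔ Vec↔Fin r) (↔-sym *↔×))

Fin4×Fin2×Vec↔Fin : ∀ r → ((Fin 4 × Fin 2) × Vec (Fin 4) r) ↔ Fin ((4 * 2) * 4 ^ r)
Fin4×Fin2×Vec↔Fin r = ↔-trans (↔-sym *↔× ×-↔ Vec↔Fin r) (↔-sym *↔×)

∀-Fin4×Fin2 : {P : Fin 4 × Fin 2 → Set} → P (0F , 0F) → P (0F , 1F) → P (1F , 0F) → P (1F , 1F) →
  P (2F , 0F) → P (2F , 1F) → P (3F , 0F) → P (3F , 1F) → ∀ z → P z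
∀-Fin4×Fin2 p₀₀ p₀₁ p₁₀ p₁₁ p₂₀ p₂₁ p₃₀ p₃₁ (0F , 0F) = p₀₀
∀-Fin4×Fin2 p₀₀ p₀₁ p₁₀ p₁₁ p₂₀ p₂₁ p₃₀ p₃₁ (0F , 1F) = p₀₁
∀-Fin4×Fin2 p₀₀ p₀₁ p₁₀ p₁₁ p₂₀ p₂₁ p₃₀ p₃₁ (1F , 0F) = p₁₀
∀-Fin4×Fin2 p₀₀ p₀₁ p₁₀ p₁₁ p₂₀ p₂₁ p₃₀ p₃₁ (1F , 1F) = p₁₁
∀-Fin4×Fin2 p₀₀ p₀₁ p₁₀ p₁₁ p₂₀ p₂₁ p₃₀ p₃₁ (2F , 0F) = p₂₀
∀-Fin4×Fin2 p₀₀ p₀₁ p₁₀ p₁₁ p₂₀ p₂₁ p₃₀ p₃₁ (2F , 1F) = p₂₁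
∀-Fin4×Fin2 p₀₀ p₀₁ p₁₀ p₁₁ p₂₀ p₂₁ p₃₀ p₃₁ (3F , 0F) = p₃₀
∀-Fin4×Fin2 p₀₀ p₀₁ p₁₀ p₁₁ p₂₀ p₂₁ p₃₀ p₃₁ (3F , 1F) = p₃₁

module LineSpread (r : ℕ) where
  G : DecAbelianGroup
  G = 𝔽₄ᵛ (suc r)
  open DecAbelianGroup G using (multiplicity; Covers)
  open Colouring G

  lines : List (Labelling G K4)
  lines = map (λ v → cayleyLabelling G K4-𝔽₄ (scalarHom v)) (projectivePoints (suc r))

  lines-cover : Covers (allDifferences lines) 0 1
  lines-cover b = begin
      multiplicity (allDifferences lines) b
    ≡⟨ cong (λ ds → multiplicity ds b) (Data.List.Properties.concatMap-map Labelling.differences _ (projectivePoints (suc r))) ⟩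
      count (λ d → ⌊ d ≟ᵛ b ⌋) (concatMap (λ v → map (_⋆ v) 𝔽₄ˣ) (projectivePoints (suc r)))
    ≡⟨ count-concatMap (λ d → ⌊ d ≟ᵛ b ⌋) (λ v → map (_⋆ v) 𝔽₄ˣ) (projectivePoints (suc r)) ⟩
      ∑[ v ∈ projectivePoints (suc r) ] count (λ d → ⌊ d ≟ᵛ b ⌋) (map (_⋆ v) 𝔽₄ˣ)
    ≡⟨ ∑-cong (λ v → trans (count-map (λ d → ⌊ d ≟ᵛ b ⌋) (_⋆ v) 𝔽₄ˣ) (count≡∑𝟙 (λ α → ⌊ α ⋆ v ≟ᵛ b ⌋) 𝔽₄ˣ))
              (projectivePoints (suc r)) ⟩
      ∑[ v ∈ projectivePoints (suc r) ] ∑[ α ∈ 𝔽₄ˣ ] 𝟙 ⌊ α ⋆ v ≟ᵛ b ⌋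
    ≡⟨ ∑-comm (projectivePoints (suc r)) 𝔽₄ˣ (λ v α → 𝟙 ⌊ α ⋆ v ≟ᵛ b ⌋) ⟩
      ∑[ α ∈ 𝔽₄ˣ ] ∑[ v ∈ projectivePoints (suc r) ] 𝟙 ⌊ α ⋆ v ≟ᵛ b ⌋
    ≡⟨ ∑-cong (λ α → sym (count≡∑𝟙 (λ v → ⌊ α ⋆ v ≟ᵛ b ⌋) (projectivePoints (suc r)))) 𝔽₄ˣ ⟩
      ∑[ α ∈ 𝔽₄ˣ ] scaledTo (suc r) α b
    ≡⟨ ∑-scaledTo (suc r) b ⟩
      (if ⌊ b ≟ᵛ replicate (suc r) 0F ⌋ then 0 else 1)
    ∎
    where open ≡-Reasoning

  perfect-s[J-E] : ∀ s n → 1 ≤ s → 3 * n ≡ s * (4 ^ suc r ∸ 1) → HasPerfectColouring 0 n (4 ^ suc r) (sJE+aE s 0)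
  perfect-s[J-E] s n 1≤s 3n≡ = perfectColouring (Vec↔Fin (suc r)) [] (concat (List.replicate s lines)) refl length≡n 1≤s
    (subst₂ (Covers (allDifferences (concat (List.replicate s lines)))) (*-zeroʳ s) (*-identityʳ s)
            (covers-replicate s lines lines-cover))
    where
    N : ℕ
    N = length (projectivePoints (suc r))
    length≡n : length (concat (List.replicate s lines)) ≡ n
    length≡n = *-cancelˡ-≡ _ _ 3 (begin
        3 * length (concat (List.replicate s lines))
      ≡⟨ cong (3 *_) (trans (length-concat-replicate s lines) (cong (s *_) (length-map _ (projectivePoints (suc r))))) ⟩
        3 * (s * N)
      ≡⟨ rearrange s N ⟩
        s * (3 * N + 1 ∸ 1)
      ≡⟨ cong (λ m → s * (m ∸ 1)) (#projectivePoints (suc r)) ⟩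
        s * (4 ^ suc r ∸ 1)
      ≡⟨ sym 3n≡ ⟩
        3 * n
      ∎)
      where
      open ≡-Reasoning
      rearrange : ∀ s N → 3 * (s * N) ≡ s * (3 * N + 1 ∸ 1)
      rearrange s N = trans (commute s N) (cong (s *_) (sym (m+n∸n≡m (3 * N) 1)))
        where
        commute : ∀ s N → 3 * (s * N) ≡ s * (3 * N)
        commute = solve-∀

module ShrikhandeDesigns (r : ℕ) where
  C : DecAbelianGroup
  C = ℤ₄ ×ᴳ ℤ₂
  private
    module C = DecAbelianGroup C
    module CC = Coordinates C
    module BC = Coordinates (C ×ᴳ 𝔽₄⁺)
  open Lifting C r
  open Colouring (C ×ᴳ 𝔽₄ᵛ r) using (perfectColouring)
  open Colouring using (allDifferences)

  4·≡εᶜ : ∀ c → 4 C.· c ≡ C.ε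
  4·≡εᶜ (c₁ , c₂) = from-yes (all? λ c₁ → all? λ c₂ → 4 C.· (c₁ , c₂) C.≟ C.ε) c₁ c₂

  4·≡εᴮ : ∀ x → 4 B.· x ≡ B.ε
  4·≡εᴮ ((c₁ , c₂) , α) = from-yes (all? λ c₁ → all? λ c₂ → all? λ α → 4 B.· ((c₁ , c₂) , α) B.≟ B.ε) c₁ c₂ α

  shrikhandeᴮ : C.Carrier × C.Carrier → Labelling (C ×ᴳ 𝔽₄⁺) Shrikhande
  shrikhandeᴮ (p , q) = BC.shrikhandeCoordinate (p , 1F) (q , 2F) (4·≡εᴮ (p , 1F)) (4·≡εᴮ (q , 2F))

  shrikhandeᶜ : C.Carrier × C.Carrier → Labelling C Shrikhande
  shrikhandeᶜ (p , q) = CC.shrikhandeCoordinate p q (4·≡εᶜ p) (4·≡εᶜ q)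

  cyclicᶜ : C.Carrier → Labelling C K4
  cyclicᶜ g = CC.cyclicCoordinate g (4·≡εᶜ g)

  liftedShrikhandes : List (Labelling (C ×ᴳ 𝔽₄⁺) Shrikhande)
  liftedShrikhandes = map shrikhandeᴮ
    (((0F , 0F) , (0F , 0F)) ∷ ((0F , 1F) , (1F , 0F)) ∷ ((1F , 0F) , (0F , 1F)) ∷ ((1F , 1F) , (1F , 0F)) ∷
     ((2F , 0F) , (2F , 1F)) ∷ ((2F , 1F) , (1F , 1F)) ∷ ((3F , 0F) , (2F , 0F)) ∷ ((3F , 1F) , (3F , 1F)) ∷ [])

  lineTable : LineTable (allDifferences _ liftedShrikhandes) 2
  lineTable (u₁ , u₂) α = check u₁ u₂ α
    where
    check : ∀ u₁ u₂ α → B.multiplicity (allDifferences _ liftedShrikhandes) ((u₁ , u₂) , α) ≡ (if ⌊ α ≟ᶠ 0F ⌋ then 0 else 2)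
    check = from-yes (all? λ u₁ → all? λ u₂ → all? λ α →
      B.multiplicity (allDifferences _ liftedShrikhandes) ((u₁ , u₂) , α) ℕ.≟ (if ⌊ α ≟ᶠ 0F ⌋ then 0 else 2))

  perfect-lifted+base : ∀ {m n a} (ssC : List (Labelling C Shrikhande)) (ksC : List (Labelling C K4)) →
    length (projectivePoints r) * 8 + length ssC ≡ m → length ksC ≡ n →
    C.Covers (allDifferences C ssC ++ allDifferences C ksC) a 2 → HasPerfectColouring m n ((4 * 2) * 4 ^ r) (sJE+aE 2 a)
  perfect-lifted+base ssC ksC m≡ n≡ covers = perfectColouring (Fin4×Fin2×Vec↔Fin r)
    (liftAll liftedShrikhandes ++ embedAll ssC) (liftAll {Γ = K4} [] ++ embedAll ksC)
    (trans (length-assembled liftedShrikhandes ssC) m≡)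
    (trans (length-assembled {Γ = K4} [] ksC) (trans (cong (_+ length ksC) (*-zeroʳ (length (projectivePoints r)))) n≡))
    (s≤s z≤n)
    (covers-assembled liftedShrikhandes [] ssC ksC lineTable lineTable-[] covers)

  perfect-2[J-E]+4E : ∀ m → length (projectivePoints r) * 8 + 3 ≡ m → HasPerfectColouring m 0 ((4 * 2) * 4 ^ r) (sJE+aE 2 4)
  perfect-2[J-E]+4E m m≡ = perfect-lifted+base ssC [] m≡ refl
    (C.covers-from-counts (allDifferences C ssC) (allDifferences C {Γ = K4} []) (∀-Fin4×Fin2 refl refl refl refl refl refl refl refl))
    where
    ssC : List (Labelling C Shrikhande)
    ssC = map shrikhandeᶜ (((1F , 0F) , (3F , 0F)) ∷ ((1F , 1F) , (3F , 1F)) ∷ ((2F , 0F) , (0F , 1F)) ∷ [])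

  perfect-2[J-E]+E-m≡8N+2 : ∀ m → length (projectivePoints r) * 8 + 2 ≡ m → HasPerfectColouring m 1 ((4 * 2) * 4 ^ r) (sJE+aE 2 1)
  perfect-2[J-E]+E-m≡8N+2 m m≡ = perfect-lifted+base ssC ksC m≡ refl
    (C.covers-from-counts (allDifferences C ssC) (allDifferences C ksC) (∀-Fin4×Fin2 refl refl refl refl refl refl refl refl))
    where
    ssC : List (Labelling C Shrikhande)
    ssC = map shrikhandeᶜ (((1F , 0F) , (1F , 1F)) ∷ ((1F , 0F) , (3F , 1F)) ∷ [])
    ksC : List (Labelling C K4)
    ksC = cyclicᶜ (2F , 0F) ∷ []

  perfect-2[J-E]+E-m≡8N+1 : ∀ m → length (projectivePoints r) * 8 + 1 ≡ m → HasPerfectColouring m 3 ((4 * 2) * 4 ^ r) (sJE+aE 2 1)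
  perfect-2[J-E]+E-m≡8N+1 m m≡ = perfect-lifted+base ssC ksC m≡ refl
    (C.covers-from-counts (allDifferences C ssC) (allDifferences C ksC) (∀-Fin4×Fin2 refl refl refl refl refl refl refl refl))
    where
    ssC : List (Labelling C Shrikhande)
    ssC = map shrikhandeᶜ (((1F , 0F) , (1F , 1F)) ∷ [])
    ksC : List (Labelling C K4)
    ksC = map cyclicᶜ ((1F , 0F) ∷ (1F , 1F) ∷ (0F , 1F) ∷ [])

module LineDesigns (r : ℕ) where
  E : DecAbelianGroup
  E = 𝔽₄⁺ ×ᴳ ℤ₂
  private
    module E = DecAbelianGroup E
    module EC = Coordinates E
    module BC = Coordinates (E ×ᴳ 𝔽₄⁺)
  open Lifting E r
  open Colouring (E ×ᴳ 𝔽₄ᵛ r) using (perfectColouring; covers-++; covers-replicate; copies; multiplicity-copies; covers-≗)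
  open Colouring using (allDifferences)

  2·≡εᴱ : ∀ c → 2 E.· c ≡ E.ε
  2·≡εᴱ (c₁ , c₂) = from-yes (all? λ c₁ → all? λ c₂ → 2 E.· (c₁ , c₂) E.≟ E.ε) c₁ c₂

  2·≡εᴮ : ∀ x → 2 B.· x ≡ B.ε
  2·≡εᴮ ((c₁ , c₂) , α) = from-yes (all? λ c₁ → all? λ c₂ → all? λ α → 2 B.· ((c₁ , c₂) , α) B.≟ B.ε) c₁ c₂ α

  -- chosen so that the K4 coordinates generated by (p , 1) and (σ p , ω), p ∈ E, form a line table
  σ : E.Carrier → E.Carrier
  σ (0F , 0F) = (0F , 0F)
  σ (0F , 1F) = (1F , 0F)
  σ (1F , 0F) = (2F , 0F)
  σ (1F , 1F) = (3F , 0F)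
  σ (2F , 0F) = (1F , 1F)
  σ (2F , 1F) = (0F , 1F)
  σ (3F , 0F) = (3F , 1F)
  σ (3F , 1F) = (2F , 1F)

  lineᴮ : E.Carrier → Labelling (E ×ᴳ 𝔽₄⁺) K4
  lineᴮ p = BC.lineCoordinate (p , 1F) (σ p , 2F) (2·≡εᴮ (p , 1F)) (2·≡εᴮ (σ p , 2F))

  shrikhandeᴮ : E.Carrier → Labelling (E ×ᴳ 𝔽₄⁺) Shrikhande
  shrikhandeᴮ p = BC.shrikhandeCoordinate (p , 1F) (σ p , 2F)
    (BC.2·≡ε⇒4·≡ε (p , 1F) (2·≡εᴮ (p , 1F))) (BC.2·≡ε⇒4·≡ε (σ p , 2F) (2·≡εᴮ (σ p , 2F)))

  lineᴱ : E.Carrier × E.Carrier → Labelling E K4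
  lineᴱ (a , b) = EC.lineCoordinate a b (2·≡εᴱ a) (2·≡εᴱ b)

  elements : List E.Carrier
  elements = (0F , 0F) ∷ (0F , 1F) ∷ (1F , 0F) ∷ (1F , 1F) ∷ (2F , 0F) ∷ (2F , 1F) ∷ (3F , 0F) ∷ (3F , 1F) ∷ []

  lineTable : LineTable (allDifferences _ (map lineᴮ elements)) 1
  lineTable (u₁ , u₂) α = check u₁ u₂ α
    where
    check : ∀ u₁ u₂ α →
      B.multiplicity (allDifferences _ (map lineᴮ elements)) ((u₁ , u₂) , α) ≡ (if ⌊ α ≟ᶠ 0F ⌋ then 0 else 1)
    check = from-yes (all? λ u₁ → all? λ u₂ → all? λ α →
      B.multiplicity (allDifferences _ (map lineᴮ elements)) ((u₁ , u₂) , α) ℕ.≟ (if ⌊ α ≟ᶠ 0F ⌋ then 0 else 1))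

  pairs : List (E.Carrier × Vec (Fin 4) r)
  pairs = concatMap (λ h → map (_, h) elements) (projectivePoints r)

  line : E.Carrier × Vec (Fin 4) r → Labelling (E ×ᴳ 𝔽₄ᵛ r) K4
  line (p , h) = mapLabelling (liftHom h) (lineᴮ p)

  shrikhande : E.Carrier × Vec (Fin 4) r → Labelling (E ×ᴳ 𝔽₄ᵛ r) Shrikhande
  shrikhande (p , h) = mapLabelling (liftHom h) (shrikhandeᴮ p)

  differences-lines : allDifferences _ (map line pairs) ≡ lifted (allDifferences _ (map lineᴮ elements))
  differences-lines = begin
      allDifferences _ (map line pairs)
    ≡⟨ Data.List.Properties.concatMap-map Labelling.differences line pairs ⟩
      concatMap (λ x → Labelling.differences (line x)) pairs
    ≡⟨ concatMap-concatMap (λ x → Labelling.differences (line x)) (λ h → map (_, h) elements) (projectivePoints r) ⟩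
      concatMap (λ h → concatMap (λ x → Labelling.differences (line x)) (map (_, h) elements)) (projectivePoints r)
    ≡⟨ concatMap-cong (λ h → trans (Data.List.Properties.concatMap-map (λ x → Labelling.differences (line x)) (_, h) elements)
         (sym (trans (Data.List.Properties.map-concatMap (Hom.⟦ liftHom h ⟧) Labelling.differences (map lineᴮ elements))
                     (Data.List.Properties.concatMap-map (λ ℓ → map (Hom.⟦ liftHom h ⟧) (Labelling.differences ℓ)) lineᴮ elements))))
         (projectivePoints r) ⟩
      lifted (allDifferences _ (map lineᴮ elements))
    ∎
    where open ≡-Reasoning

  lines-offAxis : CoversOffAxis (allDifferences _ (map line pairs)) 1
  lines-offAxis u b = trans (cong (λ ds → Gᵣ.multiplicity ds (u , b)) differences-lines)
                            (multiplicity-lifted (allDifferences _ (map lineᴮ elements)) 1 lineTable u b)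

  multiplicity-lines : ∀ L z →
    Gᵣ.multiplicity (allDifferences _ (map line L)) z ≡ ∑[ x ∈ L ] Gᵣ.multiplicity (Labelling.differences (line x)) z
  multiplicity-lines L z =
    trans (cong (λ ds → Gᵣ.multiplicity ds z) (Data.List.Properties.concatMap-map Labelling.differences line L))
          (count-concatMap (λ d → ⌊ d Gᵣ.≟ z ⌋) (λ x → Labelling.differences (line x)) L)

  multiplicity-shrikhandes : ∀ L z →
    Gᵣ.multiplicity (allDifferences _ (map shrikhande L)) z ≡ 2 * Gᵣ.multiplicity (allDifferences _ (map line L)) z
  multiplicity-shrikhandes L z = begin
      Gᵣ.multiplicity (allDifferences _ (map shrikhande L)) z
    ≡⟨ cong (λ ds → Gᵣ.multiplicity ds z) (Data.List.Properties.concatMap-map Labelling.differences shrikhande L) ⟩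
      Gᵣ.multiplicity (concatMap (λ x → Labelling.differences (shrikhande x)) L) z
    ≡⟨ count-concatMap (λ d → ⌊ d Gᵣ.≟ z ⌋) (λ x → Labelling.differences (shrikhande x)) L ⟩
      ∑[ x ∈ L ] Gᵣ.multiplicity (Labelling.differences (shrikhande x)) z
    ≡⟨ ∑-cong doubled L ⟩
      ∑[ x ∈ L ] (2 * Gᵣ.multiplicity (Labelling.differences (line x)) z)
    ≡⟨ ∑-*ˡ 2 L (λ x → Gᵣ.multiplicity (Labelling.differences (line x)) z) ⟩
      2 * ∑[ x ∈ L ] Gᵣ.multiplicity (Labelling.differences (line x)) z
    ≡⟨ cong (2 *_) (sym (multiplicity-lines L z)) ⟩
      2 * Gᵣ.multiplicity (allDifferences _ (map line L)) z
    ∎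
    where
    open ≡-Reasoning
    doubled : ∀ x → Gᵣ.multiplicity (Labelling.differences (shrikhande x)) z ≡ 2 * Gᵣ.multiplicity (Labelling.differences (line x)) z
    doubled (p , h) =
      trans (count-map (λ d → ⌊ d Gᵣ.≟ z ⌋) (Hom.⟦ liftHom h ⟧) (Labelling.differences (shrikhandeᴮ p)))
      (trans (BC.shrikhande≈2×line (p , 1F) (σ p , 2F) (2·≡εᴮ (p , 1F)) (2·≡εᴮ (σ p , 2F)) (λ d → ⌊ Hom.⟦ liftHom h ⟧ d Gᵣ.≟ z ⌋))
             (cong (2 *_) (sym (count-map (λ d → ⌊ d Gᵣ.≟ z ⌋) (Hom.⟦ liftHom h ⟧) (Labelling.differences (lineᴮ p))))))

  -- four Fano lines missing (1 , 0), and the degenerate line ((1 , 0) , (1 , 0)) with differences (1 , 0), (1 , 0), 0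
  baseLines₅ : List (Labelling E K4)
  baseLines₅ = map lineᴱ (((1F , 1F) , (2F , 0F)) ∷ ((1F , 1F) , (2F , 1F)) ∷ ((0F , 1F) , (3F , 0F)) ∷
                          ((0F , 1F) , (2F , 0F)) ∷ ((1F , 0F) , (1F , 0F)) ∷ [])

  baseLines₅-covers : E.Covers (allDifferences E baseLines₅) 1 2
  baseLines₅-covers = ∀-Fin4×Fin2 refl refl refl refl refl refl refl refl

  -- the seven lines of the Fano plane on the nonzero elements of E ≅ 𝔽₂³
  baseLines₇ : List (Labelling E K4)
  baseLines₇ = map lineᴱ (((0F , 1F) , (1F , 0F)) ∷ ((1F , 1F) , (2F , 0F)) ∷ ((1F , 1F) , (2F , 1F)) ∷ ((1F , 0F) , (2F , 1F)) ∷
                          ((0F , 1F) , (3F , 0F)) ∷ ((1F , 0F) , (2F , 0F)) ∷ ((0F , 1F) , (2F , 0F)) ∷ [])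

  baseLines₇-covers : E.Covers (allDifferences E baseLines₇) 0 3
  baseLines₇-covers = ∀-Fin4×Fin2 refl refl refl refl refl refl refl refl

  covers-copies : ∀ k (base : List (Labelling E K4)) {a} → E.Covers (allDifferences E base) a k →
    Gᵣ.Covers (allDifferences _ (copies k (map line pairs) ++ embedAll base)) a k
  covers-copies k base {a} covers =
    subst (λ ds → Gᵣ.Covers ds a k)
          (sym (trans (concatMap-++ Labelling.differences (copies k (map line pairs)) (embedAll base))
                      (cong (allDifferences _ (copies k (map line pairs)) ++_) (allDifferences-map embedHom base))))
          (covers-offAxis-++-embedded (allDifferences _ (copies k (map line pairs))) (allDifferences E base) offAxis covers)
    where
    offAxis : CoversOffAxis (allDifferences _ (copies k (map line pairs))) k
    offAxis u b = trans (multiplicity-copies k (map line pairs) (u , b))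
                        (trans (cong (k *_) (lines-offAxis u b)) (*-if ⌊ b ≟ᵛ replicate r 0F ⌋))
      where
      *-if : ∀ x → k * (if x then 0 else 1) ≡ (if x then 0 else k)
      *-if true = *-zeroʳ k
      *-if false = *-identityʳ k

  multiplicity-mixed : ∀ m z →
    Gᵣ.multiplicity (allDifferences _ (map shrikhande (take m pairs))
                     ++ allDifferences _ (copies 2 (map line (drop m pairs)) ++ embedAll baseLines₅)) z
    ≡ Gᵣ.multiplicity (allDifferences _ (copies 2 (map line pairs) ++ embedAll baseLines₅)) z
  multiplicity-mixed m z = begin
      M (allDifferences _ (map shrikhande (take m pairs)) ++ allDifferences _ (copies 2 (map line (drop m pairs)) ++ base))
    ≡⟨ Gᵣ.multiplicity-++ (allDifferences _ (map shrikhande (take m pairs))) (allDifferences _ (copies 2 (map line (drop m pairs)) ++ base)) z ⟩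
      M (allDifferences _ (map shrikhande (take m pairs))) + M (allDifferences _ (copies 2 (map line (drop m pairs)) ++ base))
    ≡⟨ cong₂ _+_ (multiplicity-shrikhandes (take m pairs) z) (split (drop m pairs)) ⟩
      2 * M (allDifferences _ (map line (take m pairs))) + (2 * M (allDifferences _ (map line (drop m pairs))) + M (allDifferences _ base))
    ≡⟨ regroup (M (allDifferences _ (map line (take m pairs)))) (M (allDifferences _ (map line (drop m pairs)))) (M (allDifferences _ base)) ⟩
      2 * (M (allDifferences _ (map line (take m pairs))) + M (allDifferences _ (map line (drop m pairs)))) + M (allDifferences _ base)
    ≡⟨ cong (λ n → 2 * n + M (allDifferences _ base)) lines-take-drop ⟩
      2 * M (allDifferences _ (map line pairs)) + M (allDifferences _ base)
    ≡⟨ sym (split pairs) ⟩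
      M (allDifferences _ (copies 2 (map line pairs) ++ base))
    ∎
    where
    open ≡-Reasoning
    M : List Gᵣ.Carrier → ℕ
    M ds = Gᵣ.multiplicity ds z
    base : List (Labelling (E ×ᴳ 𝔽₄ᵛ r) K4)
    base = embedAll baseLines₅
    split : ∀ L → M (allDifferences _ (copies 2 (map line L) ++ base)) ≡ 2 * M (allDifferences _ (map line L)) + M (allDifferences _ base)
    split L = trans (cong M (concatMap-++ Labelling.differences (copies 2 (map line L)) base))
              (trans (Gᵣ.multiplicity-++ (allDifferences _ (copies 2 (map line L))) (allDifferences _ base) z)
                     (cong (_+ M (allDifferences _ base)) (multiplicity-copies 2 (map line L) z)))
    lines-take-drop : M (allDifferences _ (map line (take m pairs))) + M (allDifferences _ (map line (drop m pairs)))
                    ≡ M (allDifferences _ (map line pairs))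
    lines-take-drop = begin
        M (allDifferences _ (map line (take m pairs))) + M (allDifferences _ (map line (drop m pairs)))
      ≡⟨ cong₂ _+_ (multiplicity-lines (take m pairs) z) (multiplicity-lines (drop m pairs) z) ⟩
        ∑[ x ∈ take m pairs ] M (Labelling.differences (line x)) + ∑[ x ∈ drop m pairs ] M (Labelling.differences (line x))
      ≡⟨ sym (∑-++ (take m pairs) (drop m pairs) (λ x → M (Labelling.differences (line x)))) ⟩
        ∑[ x ∈ take m pairs ++ drop m pairs ] M (Labelling.differences (line x))
      ≡⟨ cong (λ L → ∑[ x ∈ L ] M (Labelling.differences (line x))) (take++drop≡id m pairs) ⟩
        ∑[ x ∈ pairs ] M (Labelling.differences (line x))
      ≡⟨ sym (multiplicity-lines pairs z) ⟩
        M (allDifferences _ (map line pairs))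
      ∎
    regroup : ∀ a b c → 2 * a + (2 * b + c) ≡ 2 * (a + b) + c
    regroup = solve-∀

  length-pairs : length pairs ≡ length (projectivePoints r) * 8
  length-pairs = length-concatMap 8 (λ h → map (_, h) elements) (λ h → refl) (projectivePoints r)

  perfect-2[J-E]+E-m≤8N : ∀ m n → m ≤ length pairs → 2 * m + n ≡ 2 * length pairs + 5 →
    HasPerfectColouring m n ((4 * 2) * 4 ^ r) (sJE+aE 2 1)
  perfect-2[J-E]+E-m≤8N m n m≤ 2m+n≡ = perfectColouring (Fin4×Fin2×Vec↔Fin r)
    (map shrikhande (take m pairs)) (copies 2 (map line (drop m pairs)) ++ embedAll baseLines₅)
    (trans (length-map shrikhande (take m pairs)) (trans (length-take m pairs) (m≤n⇒m⊓n≡m m≤)))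
    (+-cancelˡ-≡ (2 * m) _ n (trans length≡ (sym 2m+n≡)))
    (s≤s z≤n)
    (covers-≗ (allDifferences _ (map shrikhande (take m pairs)) ++ allDifferences _ (copies 2 (map line (drop m pairs)) ++ embedAll baseLines₅))
              (allDifferences _ (copies 2 (map line pairs) ++ embedAll baseLines₅))
              (multiplicity-mixed m) (covers-copies 2 baseLines₅ baseLines₅-covers))
    where
    P : ℕ
    P = length pairs
    length≡ : 2 * m + length (copies 2 (map line (drop m pairs)) ++ embedAll baseLines₅) ≡ 2 * P + 5
    length≡ = begin
        2 * m + length (copies 2 (map line (drop m pairs)) ++ embedAll baseLines₅)
      ≡⟨ cong (2 * m +_) (trans (length-++ (copies 2 (map line (drop m pairs))))
            (cong (_+ 5) (trans (length-copies 2 (map line (drop m pairs)))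
                                (cong (_* 2) (trans (length-map line (drop m pairs)) (length-drop m pairs)))))) ⟩
        2 * m + ((P ∸ m) * 2 + 5)
      ≡⟨ regroup m (P ∸ m) ⟩
        2 * (m + (P ∸ m)) + 5
      ≡⟨ cong (λ k → 2 * k + 5) (m+[n∸m]≡n m≤) ⟩
        2 * P + 5
      ∎
      where
      open ≡-Reasoning
      regroup : ∀ a b → 2 * a + (b * 2 + 5) ≡ 2 * (a + b) + 5
      regroup = solve-∀

  perfect-[2x+3y][J-E]+xE : ∀ x y n → 1 ≤ 2 * x + 3 * y → x * (length pairs * 2 + 5) + y * (length pairs * 3 + 7) ≡ n →
    HasPerfectColouring 0 n ((4 * 2) * 4 ^ r) (sJE+aE (2 * x + 3 * y) x)
  perfect-[2x+3y][J-E]+xE x y n 1≤s n≡ = perfectColouring (Fin4×Fin2×Vec↔Fin r) [] ks refl length≡ 1≤s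
    (subst₂ (Gᵣ.Covers (allDifferences _ ks)) (a≡ x y) (s≡ x y) covers)
    where
    D₂ D₃ ks : List (Labelling (E ×ᴳ 𝔽₄ᵛ r) K4)
    D₂ = copies 2 (map line pairs) ++ embedAll baseLines₅
    D₃ = copies 3 (map line pairs) ++ embedAll baseLines₇
    ks = concat (List.replicate x D₂) ++ concat (List.replicate y D₃)
    covers : Gᵣ.Covers (allDifferences _ ks) (x * 1 + y * 0) (x * 2 + y * 3)
    covers = covers-++ (concat (List.replicate x D₂)) (concat (List.replicate y D₃))
      (covers-replicate x D₂ (covers-copies 2 baseLines₅ baseLines₅-covers))
      (covers-replicate y D₃ (covers-copies 3 baseLines₇ baseLines₇-covers))
    a≡ : ∀ x y → x * 1 + y * 0 ≡ x
    a≡ = solve-∀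
    s≡ : ∀ x y → x * 2 + y * 3 ≡ 2 * x + 3 * y
    s≡ = solve-∀
    length-D : ∀ k (base : List (Labelling E K4)) → length (copies k (map line pairs) ++ embedAll base) ≡ length pairs * k + length base
    length-D k base = trans (length-++ (copies k (map line pairs)))
      (cong₂ _+_ (trans (length-copies k (map line pairs)) (cong (_* k) (length-map line pairs))) (length-map (mapLabelling embedHom) base))
    length≡ : length ks ≡ n
    length≡ = trans (length-++ (concat (List.replicate x D₂)))
      (trans (cong₂ _+_ (trans (length-concat-replicate x D₂) (cong (x *_) (length-D 2 baseLines₅)))
                        (trans (length-concat-replicate y D₃) (cong (y *_) (length-D 3 baseLines₇))))
             n≡)

2^[2l∸1] : ∀ r → 2 ^ (2 * (2 + r) ∸ 1) ≡ (4 * 2) * 4 ^ r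
2^[2l∸1] r = begin
    2 ^ (2 * (2 + r) ∸ 1)   ≡⟨ cong (λ k → 2 ^ (k ∸ 1)) (double r) ⟩
    2 ^ (3 + 2 * r)         ≡⟨ ^-distribˡ-+-* 2 3 (2 * r) ⟩
    8 * 2 ^ (2 * r)         ≡⟨ cong (8 *_) (sym (^-*-assoc 2 2 r)) ⟩
    8 * 4 ^ r               ∎
  where
  open ≡-Reasoning
  double : ∀ r → 2 * (2 + r) ≡ suc (3 + 2 * r)
  double = solve-∀

2^[2l] : ∀ r → 2 ^ (2 * (2 + r)) ≡ 16 * 4 ^ r
2^[2l] r = trans (cong (2 ^_) (double r)) (trans (^-distribˡ-+-* 2 4 (2 * r)) (cong (16 *_) (sym (^-*-assoc 2 2 r))))
  where
  double : ∀ r → 2 * (2 + r) ≡ 4 + 2 * r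
  double = solve-∀

aOfResidue : ℕ → ℕ
aOfResidue 0 = 0
aOfResidue 1 = 2
aOfResidue (suc (suc _)) = 1

aOf≡aOfResidue : ∀ s → aOf s ≡ aOfResidue (s % 3)
aOf≡aOfResidue s with s % 3
... | 0 = refl
... | 1 = refl
... | suc (suc _) = refl

aOf-+3 : ∀ s → aOf (3 + s) ≡ aOf s
aOf-+3 s = begin
  aOf (3 + s)                 ≡⟨ aOf≡aOfResidue (3 + s) ⟩
  aOfResidue ((3 + s) % 3)    ≡⟨ cong (λ k → aOfResidue (k % 3)) (+-comm 3 s) ⟩
  aOfResidue ((s + 1 * 3) % 3) ≡⟨ cong aOfResidue ([m+kn]%n≡m%n s 1 3) ⟩
  aOfResidue (s % 3)          ≡⟨ sym (aOf≡aOfResidue s) ⟩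
  aOf s                       ∎
  where open ≡-Reasoning

2*aOf[s]+3*y≡s : ∀ s → 2 ≤ s → ∃ λ y → 2 * aOf s + 3 * y ≡ s
2*aOf[s]+3*y≡s 1 (s≤s ())
2*aOf[s]+3*y≡s 2 _ = 0 , refl
2*aOf[s]+3*y≡s 3 _ = 1 , refl
2*aOf[s]+3*y≡s 4 _ = 0 , refl
2*aOf[s]+3*y≡s (suc (suc (suc s@(suc (suc _))))) _ with 2*aOf[s]+3*y≡s s (s≤s (s≤s z≤n))
... | y , 2a+3y≡s = suc y , (begin
    2 * aOf (3 + s) + 3 * suc y   ≡⟨ cong (λ a → 2 * a + 3 * suc y) (aOf-+3 s) ⟩
    2 * aOf s + 3 * suc y         ≡⟨ shift (aOf s) y ⟩
    3 + (2 * aOf s + 3 * y)       ≡⟨ cong (3 +_) 2a+3y≡s ⟩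
    3 + s                         ∎)
  where
  open ≡-Reasoning
  shift : ∀ a y → 2 * a + 3 * suc y ≡ 3 + (2 * a + 3 * y)
  shift = solve-∀

8·4^r∸1 : ∀ r → 2 ^ (2 * (2 + r) ∸ 1) ∸ 1 ≡ length (projectivePoints r) * 24 + 7
8·4^r∸1 r = begin
    2 ^ (2 * (2 + r) ∸ 1) ∸ 1                         ≡⟨ cong (_∸ 1) (trans (2^[2l∸1] r) (cong (8 *_) (sym (#projectivePoints r)))) ⟩
    8 * (3 * length (projectivePoints r) + 1) ∸ 1     ≡⟨ cong (_∸ 1) (expand (length (projectivePoints r))) ⟩
    length (projectivePoints r) * 24 + 7 + 1 ∸ 1      ≡⟨ m+n∸n≡m _ 1 ⟩
    length (projectivePoints r) * 24 + 7              ∎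
  where
  open ≡-Reasoning
  expand : ∀ N → 8 * (3 * N + 1) ≡ N * 24 + 7 + 1
  expand = solve-∀

m≰M⇒m≡M+1⊎m≡M+2 : ∀ M m n → ¬ (m ≤ M) → 2 * m + n ≡ 2 * M + 5 → (M + 1 ≡ m × n ≡ 3) ⊎ (M + 2 ≡ m × n ≡ 1)
m≰M⇒m≡M+1⊎m≡M+2 M m n m≰M 2m+n≡ = from-excess (m ∸ suc M) (m+[n∸m]≡n (≰⇒> m≰M))
  where
  regroup : ∀ M t n → 2 * M + 2 + (2 * t + n) ≡ 2 * (suc M + t) + n
  regroup = solve-∀
  from-excess : ∀ t → suc M + t ≡ m → (M + 1 ≡ m × n ≡ 3) ⊎ (M + 2 ≡ m × n ≡ 1)
  from-excess t m≡ with +-cancelˡ-≡ (2 * M + 2) (2 * t + n) 3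
                       (trans (regroup M t n) (trans (cong (λ k → 2 * k + n) m≡) (trans 2m+n≡ (sym (+-assoc (2 * M) 2 3)))))
  ... | 2t+n≡3 with t
  ... | 0 = inj₁ (trans (+-suc M 0) m≡ , 2t+n≡3)
  ... | 1 = inj₂ (trans (+-suc M 1) m≡ , suc-injective (suc-injective 2t+n≡3))
  ... | suc (suc t′) = ⊥-elim (four+≢3 {2 * t′ + n} (trans (expand t′ n) 2t+n≡3))
    where
    expand : ∀ t n → 4 + (2 * t + n) ≡ 2 * suc (suc t) + n
    expand = solve-∀
    four+≢3 : ∀ {x} → 4 + x ≢ 3
    four+≢3 ()

HasPerfectColouring-H-4^l : ∀ l s n → 1 ≤ l → 1 ≤ s → 3 * n ≡ s * (4 ^ l ∸ 1) →
  HasPerfectColouring 0 n (4 ^ l) (sJE+aE s 0)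
HasPerfectColouring-H-4^l 0 s n ()
HasPerfectColouring-H-4^l (suc r) s n _ = LineSpread.perfect-s[J-E] r s n

HasPerfectColouring-H-2^[2l∸1] : ∀ l s n → 2 ≤ l → 2 ≤ s → 3 * n ≡ s * (2 ^ (2 * l ∸ 1) ∸ 1) + aOf s →
  HasPerfectColouring 0 n (2 ^ (2 * l ∸ 1)) (sJE+aE s (aOf s))
HasPerfectColouring-H-2^[2l∸1] 1 s n (s≤s ()) _ _
HasPerfectColouring-H-2^[2l∸1] (suc (suc r)) s n _ 2≤s 3n≡ with 2*aOf[s]+3*y≡s s 2≤s
... | y , 2a+3y≡s =
  subst₂ (λ k s′ → HasPerfectColouring 0 n k (sJE+aE s′ (aOf s))) (sym (2^[2l∸1] r)) 2a+3y≡s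
         (LineDesigns.perfect-[2x+3y][J-E]+xE r (aOf s) y n (subst (1 ≤_) (sym 2a+3y≡s) (≤-trans (s≤s z≤n) 2≤s)) n≡)
  where
  open LineDesigns r using (pairs; length-pairs)
  N : ℕ
  N = length (projectivePoints r)
  n≡ : aOf s * (length pairs * 2 + 5) + y * (length pairs * 3 + 7) ≡ n
  n≡ = *-cancelˡ-≡ _ n 3 (begin
      3 * (aOf s * (length pairs * 2 + 5) + y * (length pairs * 3 + 7))
    ≡⟨ cong (λ P → 3 * (aOf s * (P * 2 + 5) + y * (P * 3 + 7))) length-pairs ⟩
      3 * (aOf s * (N * 8 * 2 + 5) + y * (N * 8 * 3 + 7))
    ≡⟨ expand (aOf s) y N ⟩
      (2 * aOf s + 3 * y) * (N * 24 + 7) + aOf s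
    ≡⟨ cong₂ (λ s′ k → s′ * k + aOf s) 2a+3y≡s (sym (8·4^r∸1 r)) ⟩
      s * (2 ^ (2 * (2 + r) ∸ 1) ∸ 1) + aOf s
    ≡⟨ sym 3n≡ ⟩
      3 * n
    ∎)
    where
    open ≡-Reasoning
    expand : ∀ a y N → 3 * (a * (N * 8 * 2 + 5) + y * (N * 8 * 3 + 7)) ≡ (2 * a + 3 * y) * (N * 24 + 7) + a
    expand = solve-∀

HasPerfectColouring-D-2[J-E]+E : ∀ l m n → 2 ≤ l → 3 * (2 * m + n) ≡ 2 ^ (2 * l) ∸ 1 →
  HasPerfectColouring m n (2 ^ (2 * l ∸ 1)) (sJE+aE 2 1)
HasPerfectColouring-D-2[J-E]+E 1 m n (s≤s ()) _
HasPerfectColouring-D-2[J-E]+E (suc (suc r)) m n _ 3[2m+n]≡ =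
  subst (λ k → HasPerfectColouring m n k (sJE+aE 2 1)) (sym (2^[2l∸1] r)) (colouring (m ≤? N * 8))
  where
  open LineDesigns r using (length-pairs; perfect-2[J-E]+E-m≤8N)
  open ShrikhandeDesigns r using (perfect-2[J-E]+E-m≡8N+1; perfect-2[J-E]+E-m≡8N+2)
  N : ℕ
  N = length (projectivePoints r)
  K : ℕ
  K = (4 * 2) * 4 ^ r
  2m+n≡ : 2 * m + n ≡ 2 * (N * 8) + 5
  2m+n≡ = *-cancelˡ-≡ _ _ 3 (begin
      3 * (2 * m + n)                       ≡⟨ 3[2m+n]≡ ⟩
      2 ^ (2 * (2 + r)) ∸ 1                 ≡⟨ cong (_∸ 1) (trans (2^[2l] r) (cong (16 *_) (sym (#projectivePoints r)))) ⟩
      16 * (3 * N + 1) ∸ 1                  ≡⟨ cong (_∸ 1) (expand N) ⟩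
      3 * (2 * (N * 8) + 5) + 1 ∸ 1         ≡⟨ m+n∸n≡m _ 1 ⟩
      3 * (2 * (N * 8) + 5)                 ∎)
    where
    open ≡-Reasoning
    expand : ∀ N → 16 * (3 * N + 1) ≡ 3 * (2 * (N * 8) + 5) + 1
    expand = solve-∀
  few-K4 : (N * 8 + 1 ≡ m × n ≡ 3) ⊎ (N * 8 + 2 ≡ m × n ≡ 1) → HasPerfectColouring m n K (sJE+aE 2 1)
  few-K4 (inj₁ (m≡ , n≡3)) = subst (λ n′ → HasPerfectColouring m n′ K (sJE+aE 2 1)) (sym n≡3) (perfect-2[J-E]+E-m≡8N+1 m m≡)
  few-K4 (inj₂ (m≡ , n≡1)) = subst (λ n′ → HasPerfectColouring m n′ K (sJE+aE 2 1)) (sym n≡1) (perfect-2[J-E]+E-m≡8N+2 m m≡)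
  colouring : Dec (m ≤ N * 8) → HasPerfectColouring m n K (sJE+aE 2 1)
  colouring (yes m≤8N) = perfect-2[J-E]+E-m≤8N m n (subst (m ≤_) (sym length-pairs) m≤8N)
                                       (subst (λ P → 2 * m + n ≡ 2 * P + 5) (sym length-pairs) 2m+n≡)
  colouring (no m≰8N) = few-K4 (m≰M⇒m≡M+1⊎m≡M+2 (N * 8) m n m≰8N 2m+n≡)

HasPerfectColouring-D-2[J-E]+4E : ∀ l m → 2 ≤ l → 3 * (2 * m) ≡ 2 * (2 ^ (2 * l ∸ 1) + 1) →
  HasPerfectColouring m 0 (2 ^ (2 * l ∸ 1)) (sJE+aE 2 4)
HasPerfectColouring-D-2[J-E]+4E 1 m (s≤s ()) _
HasPerfectColouring-D-2[J-E]+4E (suc (suc r)) m _ 6m≡ =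
  subst (λ k → HasPerfectColouring m 0 k (sJE+aE 2 4)) (sym (2^[2l∸1] r)) (ShrikhandeDesigns.perfect-2[J-E]+4E r m m≡)
  where
  N : ℕ
  N = length (projectivePoints r)
  m≡ : N * 8 + 3 ≡ m
  m≡ = *-cancelˡ-≡ _ _ 6 (begin
      6 * (N * 8 + 3)                          ≡⟨ expand N ⟩
      2 * (8 * (3 * N + 1) + 1)                ≡⟨ cong (λ k → 2 * (8 * k + 1)) (#projectivePoints r) ⟩
      2 * (8 * 4 ^ r + 1)                      ≡⟨ cong (λ k → 2 * (k + 1)) (sym (2^[2l∸1] r)) ⟩
      2 * (2 ^ (2 * (2 + r) ∸ 1) + 1)          ≡⟨ sym 6m≡ ⟩
      3 * (2 * m)                              ≡⟨ sym (*-assoc 3 2 m) ⟩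
      6 * m                                    ∎)
    where
    open ≡-Reasoning
    expand : ∀ N → 6 * (N * 8 + 3) ≡ 2 * (8 * (3 * N + 1) + 1)
    expand = solve-∀

proposition10 :
    (∀ (l s n : ℕ) → 1 ≤ l → 1 ≤ s → 3 * n ≡ s * (4 ^ l ∸ 1) →
      HasPerfectColouring 0 n (4 ^ l) (sJE+aE s 0)) ×
    (∀ (l s n : ℕ) → 2 ≤ l → 2 ≤ s → 3 * n ≡ s * (2 ^ (2 * l ∸ 1) ∸ 1) + aOf s →
      HasPerfectColouring 0 n (2 ^ (2 * l ∸ 1)) (sJE+aE s (aOf s))) ×
    (∀ (l m n : ℕ) → 2 ≤ l → 3 * (2 * m + n) ≡ 2 ^ (2 * l) ∸ 1 →
      HasPerfectColouring m n (2 ^ (2 * l ∸ 1)) (sJE+aE 2 1)) ×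
    (∀ (l m : ℕ) → 2 ≤ l → 3 * (2 * m) ≡ 2 * (2 ^ (2 * l ∸ 1) + 1) →
      HasPerfectColouring m 0 (2 ^ (2 * l ∸ 1)) (sJE+aE 2 4))
proposition10 =
  HasPerfectColouring-H-4^l , HasPerfectColouring-H-2^[2l∸1] ,
  HasPerfectColouring-D-2[J-E]+E , HasPerfectColouring-D-2[J-E]+4E
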